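{- Let $j$ and $m$ be integers and $n$ a non-negative integer. Then \[ \sum_{k=0}^n(-1)^k\binom{n}{k}\frac{F_{jk+m}}{L_j^k}B_{n-k}=\begin{cases}F_mB_n\big(\frac{\alpha^j}{L_j}\big)+\frac{nF_{j(n-1)+m}}{L_j^{n-1}}, & n\text{ even},\\[4pt] -\frac{L_m}{\sqrt5}B_n\big(\frac{\alpha^j}{L_j}\big)-\frac{nF_{j(n-1)+m}}{L_j^{n-1}}, & n\text{ odd},\end{cases} \] \[ \sum_{k=0}^n(-1)^k\binom{n}{k}\frac{L_{jk+m}}{L_j^k}B_{n-k}=\begin{cases}L_mB_n\big(\frac{\alpha^j}{L_j}\big)+\frac{nL_{j(n-1)+m}}{L_j^{n-1}}, & n\text{ even},\\[4pt] -\sqrt5F_mB_n\big(\frac{\alpha^j}{L_j}\big)-\frac{nL_{j(n-1)+m}}{L_j^{n-1}}, & n\text{ odd}.\end{cases} \]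
   Context: $\alpha=\frac{1+\sqrt5}{2}$, $\beta=\frac{1-\sqrt5}{2}$. For every integer $s$, $F_s=\frac{\alpha^s-\beta^s}{\sqrt5}$ and $L_s=\alpha^s+\beta^s$ (Fibonacci and Lucas numbers extended to all integers). The Bernoulli polynomials $B_n(x)$ are defined by $\sum_{n\ge0}B_n(x)\frac{z^n}{n!}=\frac{ze^{xz}}{e^z-1}$, and $B_n=B_n(0)$. For $n=0$ the terms $nF_{j(n-1)+m}/L_j^{n-1}$ and $nL_{j(n-1)+m}/L_j^{n-1}$ are $0$. -}

module Defs where

open import Data.Nat as ℕ using (ℕ; zero; suc)
open import Data.Nat.Combinatorics using (_C_)
open import Data.Integer as ℤ using (ℤ; +_; -[1+_])
open import Data.Rational as ℚ using (ℚ; 0ℚ; 1ℚ)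
open import Data.Rational.Properties using () renaming (_≟_ to _≟ℚ_)
open import Data.List using (List; []; _∷_; _++_; [_]; length)
open import Relation.Nullary using (yes; no)

-- The field ℚ(√5): elements a + b√5 with a b ∈ ℚ (ℚ is normalised, so
-- propositional equality of Q5 is equality in ℚ(√5)).

record Q5 : Set where
  constructor _⊕_√5
  field
    re : ℚ
    im : ℚ
open Q5 public

infixl 6 _+₅_ _-₅_
infixl 7 _*₅_

fromℚ : ℚ → Q5
fromℚ q = q ⊕ 0ℚ √5

fromℤ : ℤ → Q5
fromℤ z = fromℚ (z ℚ./ 1)

fromℕ : ℕ → Q5
fromℕ n = fromℤ (+ n)

0₅ 1₅ √5 : Q5
0₅ = fromℚ 0ℚ
1₅ = fromℚ 1ℚ
√5 = 0ℚ ⊕ 1ℚ √5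

_+₅_ : Q5 → Q5 → Q5
(a ⊕ b √5) +₅ (c ⊕ d √5) = (a ℚ.+ c) ⊕ (b ℚ.+ d) √5

-₅_ : Q5 → Q5
-₅ (a ⊕ b √5) = (ℚ.- a) ⊕ (ℚ.- b) √5

_-₅_ : Q5 → Q5 → Q5
x -₅ y = x +₅ (-₅ y)

_*₅_ : Q5 → Q5 → Q5
(a ⊕ b √5) *₅ (c ⊕ d √5) =
  (a ℚ.* c ℚ.+ ((+ 5) ℚ./ 1) ℚ.* (b ℚ.* d)) ⊕ (a ℚ.* d ℚ.+ b ℚ.* c) √5

-- total inverse on ℚ (0 ↦ 0); only ever applied to nonzero values below
invℚ : ℚ → ℚ
invℚ q with q ≟ℚ 0ℚ
... | yes _  = 0ℚ
... | no q≢0 = ℚ.1/_ q {{ℚ.≢-nonZero q≢0}}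

-- total inverse on ℚ(√5): (a+b√5)⁻¹ = (a-b√5)/(a²-5b²), and 0⁻¹ := 0
inv₅ : Q5 → Q5
inv₅ (a ⊕ b √5) =
  let N = invℚ (a ℚ.* a ℚ.- ((+ 5) ℚ./ 1) ℚ.* (b ℚ.* b))
  in (a ℚ.* N) ⊕ (ℚ.- (b ℚ.* N)) √5

_/₅_ : Q5 → Q5 → Q5
x /₅ y = x *₅ inv₅ y

_^₅_ : Q5 → ℕ → Q5
x ^₅ zero  = 1₅
x ^₅ suc n = x *₅ (x ^₅ n)

_^ℤ_ : Q5 → ℤ → Q5
x ^ℤ (+ n)     = x ^₅ n
x ^ℤ -[1+ n ] = inv₅ (x ^₅ suc n)

α β : Q5
α = (1ℤ ℚ./ 2) ⊕ (1ℤ ℚ./ 2) √5  where 1ℤ = + 1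
β = (1ℤ ℚ./ 2) ⊕ (ℤ.- 1ℤ ℚ./ 2) √5  where 1ℤ = + 1

F : ℤ → Q5
F s = ((α ^ℤ s) -₅ (β ^ℤ s)) /₅ √5

L : ℤ → Q5
L s = (α ^ℤ s) +₅ (β ^ℤ s)

sumTo : ℕ → (ℕ → Q5) → Q5
sumTo zero    f = f 0
sumTo (suc n) f = sumTo n f +₅ f (suc n)

sumℚ< : ℕ → (ℕ → ℚ) → ℚ
sumℚ< zero    f = 0ℚ
sumℚ< (suc n) f = sumℚ< n f ℚ.+ f n

-- The generating function z/(e^z-1) = Σ B_n z^n/n!
-- means, comparing coefficients of z^n in (e^z-1)/z · Σ B_k z^k/k! = 1,
--     Σ_{k=0}^{n} C(n+1,k) B_k = [n = 0],
-- i.e. B_n = ([n=0] - Σ_{k<n} C(n+1,k) B_k) / (n+1).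

nth : List ℚ → ℕ → ℚ
nth []       _       = 0ℚ
nth (x ∷ xs) zero    = x
nth (x ∷ xs) (suc k) = nth xs k

δ0 : ℕ → ℚ
δ0 zero    = 1ℚ
δ0 (suc _) = 0ℚ

-- given the list [B_0,…,B_{n-1}], compute B_n
nextB : ℕ → List ℚ → ℚ
nextB n bs =
  (δ0 n ℚ.- sumℚ< n (λ k → ((+ (suc n C k)) ℚ./ 1) ℚ.* nth bs k))
    ℚ.* ((+ 1) ℚ./ suc n)

bernList : ℕ → List ℚ
bernList zero    = []
bernList (suc n) = bernList n ++ [ nextB n (bernList n) ]

Bern : ℕ → ℚ
Bern n = nextB n (bernList n)

-- Bernoulli polynomials, B_n(x) = Σ_{k=0}^{n} C(n,k) B_k x^{n-k}
-- (coefficient extraction from z e^{xz}/(e^z-1) = e^{xz} · z/(e^z-1)),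
-- evaluated at x ∈ ℚ(√5).
BernPoly : ℕ → Q5 → Q5
BernPoly n x =
  sumTo n (λ k → fromℕ (n C k) *₅ fromℚ (Bern k) *₅ (x ^₅ (n ℕ.∸ k)))

sgn : ℕ → Q5
sgn k = (-₅ 1₅) ^₅ k

{-# OPTIONS --safe #-}
module Submission where

-- With t = αʲ/Lⱼ one has βʲ/Lⱼ = 1 - t, so for a Binet form Gₛ = u αˢ + v βˢ
-- (Fₛ and Lₛ are two) the k-th summand is C(n,k) B_{n-k} times
-- (u αᵐ)(-t)ᵏ + (v βᵐ)(-(1-t))ᵏ, and the sum is u αᵐ Bₙ(-t) + v βᵐ Bₙ(t - 1).
-- Both are evaluated by Bₙ(-x) = (-1)ⁿ (Bₙ(x) + n xⁿ⁻¹) and the reflection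
-- Bₙ(1 - x) = (-1)ⁿ Bₙ(x).  These follow from the translation formula
-- Bₙ(x + 1) = Bₙ(x) + n xⁿ⁻¹ and the vanishing of the odd Bernoulli numbers
-- beyond B₁, which holds because (-1)ᵏ Bₖ - [k ≡ 1] satisfies the recurrence
-- Σ_{k≤n} C(n+1,k) Bₖ = [n ≡ 0] that determines the Bₖ.  Finally Lⱼ is
-- invertible in ℚ(√5): Lₖ = 2 re αᵏ > 0 and L₋ₖ = (-1)ᵏ Lₖ.

open import Defs
open import Data.Nat using (ℕ; _∸_; _%_)
open import Data.Nat.Combinatorics using (_C_)
open import Data.Integer using (ℤ; +_; _+_; _*_; _-_)
open import Data.Product using (_×_)
open import Relation.Binary.PropositionalEquality using (_≡_)

open import Algebra.Bundles using (CommutativeRing)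
open import Algebra.Structures using (IsCommutativeRing)
open import Data.Empty using (⊥-elim)
open import Data.Integer as ℤ using (-[1+_]; _⊖_)
import Data.Integer.Properties as ℤₚ
import Data.Integer.Tactic.RingSolver as ℤ-Solver
open import Data.List using (List; []; _∷_; _++_; [_]; length)
import Data.List.Properties as Listₚ
open import Data.Maybe using (Maybe; just; nothing)
open import Data.Nat as ℕ
  using (zero; suc; _≤_; _<_; _≤′_; ≤′-reflexive; ≤′-step; z≤n; s≤s; _!)
import Data.Nat.Properties as ℕₚ
import Data.Nat.Tactic.RingSolver as ℕ-Solver
open import Data.Nat.Combinatorics
  using ( nCk≡nC[n∸k]; nCk≡n!/k![n-k]!; k![n∸k]!∣n!; nCn≡1; nC1≡n; k>n⇒nCk≡0
        ; nCk+nC[k+1]≡[n+1]C[k+1])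
open import Data.Nat.DivMod using (m/n*n≡m; m≡m%n+[m/n]*n)
open import Data.Nat.Induction using (<-rec)
open import Data.Product using (_,_; proj₁; proj₂)
open import Data.Rational as ℚ using (ℚ; 0ℚ; 1ℚ)
import Data.Rational.Properties as ℚₚ
open import Data.Rational.Unnormalised as ℚᵘ using (mkℚᵘ; *≡*)
import Data.Rational.Unnormalised.Properties as ℚᵘₚ
open import Data.Sum using (inj₁; inj₂)
open import Relation.Nullary using (yes; no; ¬_)
open import Relation.Nullary.Decidable using (dec⇒maybe)
open import Relation.Binary.PropositionalEquality
  using (refl; sym; trans; cong; cong₂; subst; isEquivalence; module ≡-Reasoning)
open import Tactic.RingSolver using (solve-∀)
open import Tactic.RingSolver.Core.AlmostCommutativeRing
  using (AlmostCommutativeRing; fromCommutativeRing)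

open ≡-Reasoning

ℚ-ring : AlmostCommutativeRing _ _
ℚ-ring = fromCommutativeRing ℚₚ.+-*-commutativeRing (λ x → dec⇒maybe (0ℚ ℚₚ.≟ x))

⊕-cong : ∀ {a b c d} → a ≡ c → b ≡ d → a ⊕ b √5 ≡ c ⊕ d √5
⊕-cong = cong₂ _⊕_√5

+₅-assoc : ∀ x y z → (x +₅ y) +₅ z ≡ x +₅ (y +₅ z)
+₅-assoc (a ⊕ b √5) (c ⊕ d √5) (e ⊕ f √5) = ⊕-cong (ℚₚ.+-assoc a c e) (ℚₚ.+-assoc b d f)

+₅-comm : ∀ x y → x +₅ y ≡ y +₅ x
+₅-comm (a ⊕ b √5) (c ⊕ d √5) = ⊕-cong (ℚₚ.+-comm a c) (ℚₚ.+-comm b d)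

+₅-identityˡ : ∀ x → 0₅ +₅ x ≡ x
+₅-identityˡ (a ⊕ b √5) = ⊕-cong (ℚₚ.+-identityˡ a) (ℚₚ.+-identityˡ b)

+₅-inverseˡ : ∀ x → (-₅ x) +₅ x ≡ 0₅
+₅-inverseˡ (a ⊕ b √5) = ⊕-cong (ℚₚ.+-inverseˡ a) (ℚₚ.+-inverseˡ b)

five : ℚ
five = + 5 ℚ./ 1

-- The factor 5 = √5² in the rational part of a product is abstracted to a
-- variable k, so that the identities below are ring identities over ℚ.
*₅-assoc : ∀ x y z → (x *₅ y) *₅ z ≡ x *₅ (y *₅ z)
*₅-assoc (a ⊕ b √5) (c ⊕ d √5) (e ⊕ f √5) = ⊕-cong (re-assoc a b c d e f five) (im-assoc a b c d e f five)
  where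
  re-assoc : ∀ a b c d e f k →
    (a ℚ.* c ℚ.+ k ℚ.* (b ℚ.* d)) ℚ.* e ℚ.+ k ℚ.* ((a ℚ.* d ℚ.+ b ℚ.* c) ℚ.* f)
      ≡ a ℚ.* (c ℚ.* e ℚ.+ k ℚ.* (d ℚ.* f)) ℚ.+ k ℚ.* (b ℚ.* (c ℚ.* f ℚ.+ d ℚ.* e))
  re-assoc = solve-∀ ℚ-ring
  im-assoc : ∀ a b c d e f k →
    (a ℚ.* c ℚ.+ k ℚ.* (b ℚ.* d)) ℚ.* f ℚ.+ (a ℚ.* d ℚ.+ b ℚ.* c) ℚ.* e
      ≡ a ℚ.* (c ℚ.* f ℚ.+ d ℚ.* e) ℚ.+ b ℚ.* (c ℚ.* e ℚ.+ k ℚ.* (d ℚ.* f))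
  im-assoc = solve-∀ ℚ-ring

*₅-comm : ∀ x y → x *₅ y ≡ y *₅ x
*₅-comm (a ⊕ b √5) (c ⊕ d √5) = ⊕-cong (re-comm a b c d five) (im-comm a b c d)
  where
  re-comm : ∀ a b c d k → a ℚ.* c ℚ.+ k ℚ.* (b ℚ.* d) ≡ c ℚ.* a ℚ.+ k ℚ.* (d ℚ.* b)
  re-comm = solve-∀ ℚ-ring
  im-comm : ∀ a b c d → a ℚ.* d ℚ.+ b ℚ.* c ≡ c ℚ.* b ℚ.+ d ℚ.* a
  im-comm = solve-∀ ℚ-ring

*₅-identityˡ : ∀ x → 1₅ *₅ x ≡ x
*₅-identityˡ (a ⊕ b √5) = ⊕-cong (re-identity a b five) (im-identity a b)
  where
  re-identity : ∀ a b k → 1ℚ ℚ.* a ℚ.+ k ℚ.* (0ℚ ℚ.* b) ≡ a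
  re-identity = solve-∀ ℚ-ring
  im-identity : ∀ a b → 1ℚ ℚ.* b ℚ.+ 0ℚ ℚ.* a ≡ b
  im-identity = solve-∀ ℚ-ring

*₅-distribˡ : ∀ x y z → x *₅ (y +₅ z) ≡ x *₅ y +₅ x *₅ z
*₅-distribˡ (a ⊕ b √5) (c ⊕ d √5) (e ⊕ f √5) = ⊕-cong (re-distrib a b c d e f five) (im-distrib a b c d e f)
  where
  re-distrib : ∀ a b c d e f k →
    a ℚ.* (c ℚ.+ e) ℚ.+ k ℚ.* (b ℚ.* (d ℚ.+ f))
      ≡ (a ℚ.* c ℚ.+ k ℚ.* (b ℚ.* d)) ℚ.+ (a ℚ.* e ℚ.+ k ℚ.* (b ℚ.* f))
  re-distrib = solve-∀ ℚ-ring
  im-distrib : ∀ a b c d e f →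
    a ℚ.* (d ℚ.+ f) ℚ.+ b ℚ.* (c ℚ.+ e) ≡ (a ℚ.* d ℚ.+ b ℚ.* c) ℚ.+ (a ℚ.* f ℚ.+ b ℚ.* e)
  im-distrib = solve-∀ ℚ-ring

Q5-isCommutativeRing : IsCommutativeRing _≡_ _+₅_ _*₅_ (λ x → -₅ x) 0₅ 1₅
Q5-isCommutativeRing = record
  { isRing = record
    { +-isAbelianGroup = record
      { isGroup = record
        { isMonoid = record
          { isSemigroup = record
            { isMagma = record { isEquivalence = isEquivalence ; ∙-cong = cong₂ _+₅_ }
            ; assoc = +₅-assoc }
          ; identity = +₅-identityˡ , λ x → trans (+₅-comm x 0₅) (+₅-identityˡ x) }
        ; inverse = +₅-inverseˡ , λ x → trans (+₅-comm x (-₅ x)) (+₅-inverseˡ x)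
        ; ⁻¹-cong = cong (λ x → -₅ x) }
      ; comm = +₅-comm }
    ; *-cong = cong₂ _*₅_
    ; *-assoc = *₅-assoc
    ; *-identity = *₅-identityˡ , λ x → trans (*₅-comm x 1₅) (*₅-identityˡ x)
    ; distrib = *₅-distribˡ , λ x y z → trans (*₅-comm (y +₅ z) x)
                  (trans (*₅-distribˡ x y z) (cong₂ _+₅_ (*₅-comm x y) (*₅-comm x z))) }
  ; *-comm = *₅-comm }

Q5-commutativeRing : CommutativeRing _ _
Q5-commutativeRing = record { isCommutativeRing = Q5-isCommutativeRing }

Q5-ring : AlmostCommutativeRing _ _
Q5-ring = fromCommutativeRing Q5-commutativeRing 0≟
  where
  0≟ : (x : Q5) → Maybe (0₅ ≡ x)
  0≟ (a ⊕ b √5) with 0ℚ ℚₚ.≟ a | 0ℚ ℚₚ.≟ b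
  ... | yes refl | yes refl = just refl
  ... | _        | _        = nothing

+₅-identityʳ : ∀ x → x +₅ 0₅ ≡ x
+₅-identityʳ = solve-∀ Q5-ring

*₅-identityʳ : ∀ x → x *₅ 1₅ ≡ x
*₅-identityʳ = solve-∀ Q5-ring

*₅-zeroˡ : ∀ x → 0₅ *₅ x ≡ 0₅
*₅-zeroˡ = solve-∀ Q5-ring

fromℚ-* : ∀ p q → fromℚ (p ℚ.* q) ≡ fromℚ p *₅ fromℚ q
fromℚ-* p q = ⊕-cong (re-* p q five) (im-* p q)
  where
  re-* : ∀ p q k → p ℚ.* q ≡ p ℚ.* q ℚ.+ k ℚ.* (0ℚ ℚ.* 0ℚ)
  re-* = solve-∀ ℚ-ring
  im-* : ∀ p q → 0ℚ ≡ p ℚ.* 0ℚ ℚ.+ 0ℚ ℚ.* q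
  im-* = solve-∀ ℚ-ring

ι : ℕ → ℚ
ι n = + n ℚ./ 1

-- ι n is definitionally fromℚᵘ (mkℚᵘ (+ n) 0), so its arithmetic is read off in ℚᵘ.
toℚᵘ-ι : ∀ n → ℚ.toℚᵘ (ι n) ℚᵘ.≃ mkℚᵘ (+ n) 0
toℚᵘ-ι n = ℚₚ.toℚᵘ-fromℚᵘ (mkℚᵘ (+ n) 0)

ι-+ : ∀ m n → ι (m ℕ.+ n) ≡ ι m ℚ.+ ι n
ι-+ m n = ℚₚ.toℚᵘ-injective (beginᵘ
  ℚ.toℚᵘ (ι (m ℕ.+ n))               ≈⟨ toℚᵘ-ι (m ℕ.+ n) ⟩
  mkℚᵘ (+ (m ℕ.+ n)) 0               ≈⟨ *≡* (trans (cong (ℤ._* + 1) (ℤₚ.pos-+ m n))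
                                                    (cross-multiply (+ m) (+ n))) ⟩
  mkℚᵘ (+ m) 0 ℚᵘ.+ mkℚᵘ (+ n) 0     ≈⟨ ℚᵘₚ.+-cong (toℚᵘ-ι m) (toℚᵘ-ι n) ⟨
  ℚ.toℚᵘ (ι m) ℚᵘ.+ ℚ.toℚᵘ (ι n)     ≈⟨ ℚₚ.toℚᵘ-homo-+ (ι m) (ι n) ⟨
  ℚ.toℚᵘ (ι m ℚ.+ ι n)               ∎ᵘ)
  where
  open ℚᵘₚ.≃-Reasoning renaming (begin_ to beginᵘ_; _∎ to _∎ᵘ)
  cross-multiply : ∀ x y → (x + y) ℤ.* + 1 ≡ (x ℤ.* + 1 + y ℤ.* + 1) ℤ.* + 1
  cross-multiply = ℤ-Solver.solve-∀

ι-* : ∀ m n → ι (m ℕ.* n) ≡ ι m ℚ.* ι n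
ι-* m n = ℚₚ.toℚᵘ-injective (beginᵘ
  ℚ.toℚᵘ (ι (m ℕ.* n))               ≈⟨ toℚᵘ-ι (m ℕ.* n) ⟩
  mkℚᵘ (+ (m ℕ.* n)) 0               ≈⟨ *≡* (cong (ℤ._* + 1) (ℤₚ.pos-* m n)) ⟩
  mkℚᵘ (+ m) 0 ℚᵘ.* mkℚᵘ (+ n) 0     ≈⟨ ℚᵘₚ.*-cong (toℚᵘ-ι m) (toℚᵘ-ι n) ⟨
  ℚ.toℚᵘ (ι m) ℚᵘ.* ℚ.toℚᵘ (ι n)     ≈⟨ ℚₚ.toℚᵘ-homo-* (ι m) (ι n) ⟨
  ℚ.toℚᵘ (ι m ℚ.* ι n)               ∎ᵘ)
  where open ℚᵘₚ.≃-Reasoning renaming (begin_ to beginᵘ_; _∎ to _∎ᵘ)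

fromℕ-+ : ∀ m n → fromℕ (m ℕ.+ n) ≡ fromℕ m +₅ fromℕ n
fromℕ-+ m n = cong fromℚ (ι-+ m n)

fromℕ-* : ∀ m n → fromℕ (m ℕ.* n) ≡ fromℕ m *₅ fromℕ n
fromℕ-* m n = trans (cong fromℚ (ι-* m n)) (fromℚ-* (ι m) (ι n))

ι[1+n]*1/[1+n]≡1 : ∀ n → ι (suc n) ℚ.* (+ 1 ℚ./ suc n) ≡ 1ℚ
ι[1+n]*1/[1+n]≡1 n = ℚₚ.toℚᵘ-injective (beginᵘ
  ℚ.toℚᵘ (ι (suc n) ℚ.* (+ 1 ℚ./ suc n))
    ≈⟨ ℚₚ.toℚᵘ-homo-* (ι (suc n)) (+ 1 ℚ./ suc n) ⟩
  ℚ.toℚᵘ (ι (suc n)) ℚᵘ.* ℚ.toℚᵘ (+ 1 ℚ./ suc n)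
    ≈⟨ ℚᵘₚ.*-cong (toℚᵘ-ι (suc n)) (ℚₚ.toℚᵘ-fromℚᵘ (mkℚᵘ (+ 1) n)) ⟩
  mkℚᵘ (+ suc n) 0 ℚᵘ.* mkℚᵘ (+ 1) n
    ≈⟨ *≡* (cross-multiply (+ suc n)) ⟩
  ℚ.toℚᵘ 1ℚ ∎ᵘ)
  where
  open ℚᵘₚ.≃-Reasoning renaming (begin_ to beginᵘ_; _∎ to _∎ᵘ)
  cross-multiply : ∀ x → (x ℤ.* + 1) ℤ.* + 1 ≡ + 1 ℤ.* (+ 1 ℤ.* x)
  cross-multiply = ℤ-Solver.solve-∀

fromℕ-suc-cancelˡ : ∀ n {x y} → fromℕ (suc n) *₅ x ≡ fromℕ (suc n) *₅ y → x ≡ y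
fromℕ-suc-cancelˡ n {x} {y} eq = begin
  x                   ≡⟨ cancel x ⟨
  (u *₅ c) *₅ x       ≡⟨ *₅-assoc u c x ⟩
  u *₅ (c *₅ x)       ≡⟨ cong (u *₅_) eq ⟩
  u *₅ (c *₅ y)       ≡⟨ *₅-assoc u c y ⟨
  (u *₅ c) *₅ y       ≡⟨ cancel y ⟩
  y                   ∎
  where
  c = fromℕ (suc n)
  u = fromℚ (+ 1 ℚ./ suc n)
  u*c≡1 : u *₅ c ≡ 1₅
  u*c≡1 = trans (*₅-comm u c)
                (trans (sym (fromℚ-* (ι (suc n)) (+ 1 ℚ./ suc n))) (cong fromℚ (ι[1+n]*1/[1+n]≡1 n)))
  cancel : ∀ z → (u *₅ c) *₅ z ≡ z
  cancel z = trans (cong (_*₅ z) u*c≡1) (*₅-identityˡ z)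

+₅-cancelˡ : ∀ x {y z} → x +₅ y ≡ x +₅ z → y ≡ z
+₅-cancelˡ x {y} {z} eq = trans (undo x y) (trans (cong (-₅ x +₅_) eq) (sym (undo x z)))
  where
  undo : ∀ x y → y ≡ -₅ x +₅ (x +₅ y)
  undo = solve-∀ Q5-ring

sumTo-cong≤ : ∀ n {f g : ℕ → Q5} → (∀ k → k ≤ n → f k ≡ g k) → sumTo n f ≡ sumTo n g
sumTo-cong≤ zero    f≗g = f≗g 0 z≤n
sumTo-cong≤ (suc n) f≗g =
  cong₂ _+₅_ (sumTo-cong≤ n (λ k k≤n → f≗g k (ℕₚ.m≤n⇒m≤1+n k≤n))) (f≗g (suc n) ℕₚ.≤-refl)

sumTo-cong : ∀ n {f g : ℕ → Q5} → (∀ k → f k ≡ g k) → sumTo n f ≡ sumTo n g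
sumTo-cong n f≗g = sumTo-cong≤ n (λ k _ → f≗g k)

sumTo-+ : ∀ n (f g : ℕ → Q5) → sumTo n (λ k → f k +₅ g k) ≡ sumTo n f +₅ sumTo n g
sumTo-+ zero    f g = refl
sumTo-+ (suc n) f g =
  trans (cong (_+₅ (f (suc n) +₅ g (suc n))) (sumTo-+ n f g))
        (interchange (sumTo n f) (sumTo n g) (f (suc n)) (g (suc n)))
  where
  interchange : ∀ a b c d → (a +₅ b) +₅ (c +₅ d) ≡ (a +₅ c) +₅ (b +₅ d)
  interchange = solve-∀ Q5-ring

sumTo-*ˡ : ∀ n c (f : ℕ → Q5) → sumTo n (λ k → c *₅ f k) ≡ c *₅ sumTo n f
sumTo-*ˡ zero    c f = refl
sumTo-*ˡ (suc n) c f =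
  trans (cong (_+₅ c *₅ f (suc n)) (sumTo-*ˡ n c f)) (sym (*₅-distribˡ c (sumTo n f) (f (suc n))))

sumTo-linear : ∀ n c d (f g : ℕ → Q5) →
  sumTo n (λ k → c *₅ f k +₅ d *₅ g k) ≡ c *₅ sumTo n f +₅ d *₅ sumTo n g
sumTo-linear n c d f g = trans (sumTo-+ n (λ k → c *₅ f k) (λ k → d *₅ g k))
                               (cong₂ _+₅_ (sumTo-*ˡ n c f) (sumTo-*ˡ n d g))

sumTo-suc : ∀ n (f : ℕ → Q5) → sumTo (suc n) f ≡ f 0 +₅ sumTo n (λ k → f (suc k))
sumTo-suc zero    f = refl
sumTo-suc (suc n) f = trans (cong (_+₅ f (suc (suc n))) (sumTo-suc n f)) (+₅-assoc (f 0) _ _)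

sumTo-reverse : ∀ n (f : ℕ → Q5) → sumTo n f ≡ sumTo n (λ k → f (n ∸ k))
sumTo-reverse zero    f = refl
sumTo-reverse (suc n) f = begin
  sumTo n f +₅ f (suc n)                    ≡⟨ cong (_+₅ f (suc n)) (sumTo-reverse n f) ⟩
  sumTo n (λ k → f (n ∸ k)) +₅ f (suc n)    ≡⟨ +₅-comm _ (f (suc n)) ⟩
  f (suc n) +₅ sumTo n (λ k → f (n ∸ k))    ≡⟨ sumTo-suc n (λ k → f (suc n ∸ k)) ⟨
  sumTo (suc n) (λ k → f (suc n ∸ k))       ∎

sumTo-swap : ∀ n m (g : ℕ → ℕ → Q5) →
  sumTo n (λ i → sumTo m (g i)) ≡ sumTo m (λ k → sumTo n (λ i → g i k))
sumTo-swap zero    m g = refl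
sumTo-swap (suc n) m g = trans (cong (_+₅ sumTo m (g (suc n))) (sumTo-swap n m g))
                               (sym (sumTo-+ m (λ k → sumTo n (λ i → g i k)) (g (suc n))))

sumTo-extend : ∀ {M N} (f : ℕ → Q5) → M ≤ N → (∀ k → M < k → f k ≡ 0₅) → sumTo N f ≡ sumTo M f
sumTo-extend {M} f M≤N vanish = go (ℕₚ.≤⇒≤′ M≤N)
  where
  go : ∀ {N} → M ≤′ N → sumTo N f ≡ sumTo M f
  go (≤′-reflexive refl)     = refl
  go {suc N} (≤′-step M≤′N) = trans (cong₂ _+₅_ (go M≤′N) (vanish (suc N) (s≤s (ℕₚ.≤′⇒≤ M≤′N))))
                                    (+₅-identityʳ (sumTo M f))

sumTo-zero : ∀ n (f : ℕ → Q5) → (∀ k → f k ≡ 0₅) → sumTo n f ≡ 0₅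
sumTo-zero zero    f f≗0 = f≗0 0
sumTo-zero (suc n) f f≗0 = trans (cong₂ _+₅_ (sumTo-zero n f f≗0) (f≗0 (suc n))) (+₅-identityˡ 0₅)

^₅-+ : ∀ x m n → x ^₅ (m ℕ.+ n) ≡ x ^₅ m *₅ x ^₅ n
^₅-+ x zero    n = sym (*₅-identityˡ _)
^₅-+ x (suc m) n = trans (cong (x *₅_) (^₅-+ x m n)) (sym (*₅-assoc x _ _))

^₅-distrib-* : ∀ x y n → (x *₅ y) ^₅ n ≡ x ^₅ n *₅ y ^₅ n
^₅-distrib-* x y zero    = sym (*₅-identityˡ 1₅)
^₅-distrib-* x y (suc n) = trans (cong ((x *₅ y) *₅_) (^₅-distrib-* x y n)) (interchange x y _ _)
  where
  interchange : ∀ a b c d → (a *₅ b) *₅ (c *₅ d) ≡ (a *₅ c) *₅ (b *₅ d)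
  interchange = solve-∀ Q5-ring

1^₅n≡1 : ∀ n → 1₅ ^₅ n ≡ 1₅
1^₅n≡1 zero    = refl
1^₅n≡1 (suc n) = trans (*₅-identityˡ _) (1^₅n≡1 n)

-₅-^₅ : ∀ x n → (-₅ x) ^₅ n ≡ sgn n *₅ x ^₅ n
-₅-^₅ x n = trans (cong (_^₅ n) (-x≡-1*x x)) (^₅-distrib-* (-₅ 1₅) x n)
  where
  -x≡-1*x : ∀ x → -₅ x ≡ (-₅ 1₅) *₅ x
  -x≡-1*x = solve-∀ Q5-ring

sgn-+ : ∀ m n → sgn (m ℕ.+ n) ≡ sgn m *₅ sgn n
sgn-+ = ^₅-+ (-₅ 1₅)

sgn*sgn≡1 : ∀ n → sgn n *₅ sgn n ≡ 1₅
sgn*sgn≡1 n = trans (sym (^₅-distrib-* (-₅ 1₅) (-₅ 1₅) n)) (1^₅n≡1 n)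

sgn-∸ : ∀ n k → k ≤ n → sgn (n ∸ k) ≡ sgn n *₅ sgn k
sgn-∸ n k k≤n = begin
  sgn (n ∸ k)                       ≡⟨ *₅-identityˡ _ ⟨
  1₅ *₅ sgn (n ∸ k)                 ≡⟨ cong (_*₅ sgn (n ∸ k)) (sgn*sgn≡1 k) ⟨
  (sgn k *₅ sgn k) *₅ sgn (n ∸ k)   ≡⟨ rearrange (sgn k) (sgn (n ∸ k)) ⟩
  (sgn k *₅ sgn (n ∸ k)) *₅ sgn k   ≡⟨ cong (_*₅ sgn k) (sgn-+ k (n ∸ k)) ⟨
  sgn (k ℕ.+ (n ∸ k)) *₅ sgn k      ≡⟨ cong (λ i → sgn i *₅ sgn k) (ℕₚ.m+[n∸m]≡n k≤n) ⟩
  sgn n *₅ sgn k                    ∎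
  where
  rearrange : ∀ s t → (s *₅ s) *₅ t ≡ (s *₅ t) *₅ s
  rearrange = solve-∀ Q5-ring

sgn-%2 : ∀ n → sgn n ≡ sgn (n % 2)
sgn-%2 n = begin
  sgn n                                   ≡⟨ cong sgn (m≡m%n+[m/n]*n n 2) ⟩
  sgn (n % 2 ℕ.+ n ℕ./ 2 ℕ.* 2)          ≡⟨ sgn-+ (n % 2) _ ⟩
  sgn (n % 2) *₅ sgn (n ℕ./ 2 ℕ.* 2)     ≡⟨ cong (sgn (n % 2) *₅_) (sgn-even (n ℕ./ 2)) ⟩
  sgn (n % 2) *₅ 1₅                       ≡⟨ *₅-identityʳ _ ⟩
  sgn (n % 2)                             ∎
  where
  sgn-even : ∀ q → sgn (q ℕ.* 2) ≡ 1₅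
  sgn-even zero    = refl
  sgn-even (suc q) = trans (sgn-+ 2 (q ℕ.* 2)) (cong (sgn 2 *₅_) (sgn-even q))

nCk*k!*[n∸k]!≡n! : ∀ {n k} → k ≤ n → (n C k) ℕ.* (k ! ℕ.* (n ∸ k) !) ≡ n !
nCk*k!*[n∸k]!≡n! {n} {k} k≤n =
  trans (cong (ℕ._* (k ! ℕ.* (n ∸ k) !)) (nCk≡n!/k![n-k]! k≤n))
        (m/n*n≡m {{ℕₚ._!*_!≢0 k (n ∸ k)}} (k![n∸k]!∣n! k≤n))

nCk*[n∸k]Ci*k!*i!*[n∸k∸i]!≡n! : ∀ {n k i} → k ≤ n → i ≤ n ∸ k →
  (n C k) ℕ.* ((n ∸ k) C i) ℕ.* (k ! ℕ.* (i ! ℕ.* (n ∸ k ∸ i) !)) ≡ n !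
nCk*[n∸k]Ci*k!*i!*[n∸k∸i]!≡n! {n} {k} {i} k≤n i≤n∸k = begin
  (n C k) ℕ.* ((n ∸ k) C i) ℕ.* (k ! ℕ.* (i ! ℕ.* (n ∸ k ∸ i) !))
    ≡⟨ rearrange (n C k) ((n ∸ k) C i) (k !) (i ! ℕ.* (n ∸ k ∸ i) !) ⟩
  (n C k) ℕ.* (k ! ℕ.* (((n ∸ k) C i) ℕ.* (i ! ℕ.* (n ∸ k ∸ i) !)))
    ≡⟨ cong (λ x → (n C k) ℕ.* (k ! ℕ.* x)) (nCk*k!*[n∸k]!≡n! i≤n∸k) ⟩
  (n C k) ℕ.* (k ! ℕ.* (n ∸ k) !)
    ≡⟨ nCk*k!*[n∸k]!≡n! k≤n ⟩
  n ! ∎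
  where
  rearrange : ∀ p q r s → p ℕ.* q ℕ.* (r ℕ.* s) ≡ p ℕ.* (r ℕ.* (q ℕ.* s))
  rearrange = ℕ-Solver.solve-∀

-- Both sides count the ways to pick disjoint subsets of sizes k and i.
nCk*[n∸k]Ci≡nCi*[n∸i]Ck : ∀ n k i → (n C k) ℕ.* ((n ∸ k) C i) ≡ (n C i) ℕ.* ((n ∸ i) C k)
nCk*[n∸k]Ci≡nCi*[n∸i]Ck n k i with k ℕ.+ i ℕ.≤? n
... | no  k+i≰n = trans (vanishes k i k+i≰n)
                        (sym (vanishes i k (λ i+k≤n → k+i≰n (subst (_≤ n) (ℕₚ.+-comm i k) i+k≤n))))
  where
  vanishes : ∀ a b → ¬ (a ℕ.+ b ≤ n) → (n C a) ℕ.* ((n ∸ a) C b) ≡ 0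
  vanishes a b a+b≰n with a ℕ.≤? n
  ... | no  a≰n = cong (ℕ._* ((n ∸ a) C b)) (k>n⇒nCk≡0 (ℕₚ.≰⇒> a≰n))
  ... | yes a≤n = trans (cong ((n C a) ℕ.*_) (k>n⇒nCk≡0 (ℕₚ.≰⇒> b≰n∸a))) (ℕₚ.*-zeroʳ (n C a))
    where
    b≰n∸a : ¬ (b ≤ n ∸ a)
    b≰n∸a b≤ = a+b≰n (subst (a ℕ.+ b ≤_) (ℕₚ.m+[n∸m]≡n a≤n) (ℕₚ.+-monoʳ-≤ a b≤))
... | yes k+i≤n = ℕₚ.*-cancelʳ-≡ _ _ D {{D≢0}} (begin
  (n C k) ℕ.* ((n ∸ k) C i) ℕ.* D
    ≡⟨ nCk*[n∸k]Ci*k!*i!*[n∸k∸i]!≡n! (ℕₚ.m+n≤o⇒m≤o k k+i≤n) i≤n∸k ⟩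
  n !
    ≡⟨ nCk*[n∸k]Ci*k!*i!*[n∸k∸i]!≡n! (ℕₚ.m+n≤o⇒n≤o k k+i≤n) k≤n∸i ⟨
  (n C i) ℕ.* ((n ∸ i) C k) ℕ.* (i ! ℕ.* (k ! ℕ.* (n ∸ i ∸ k) !))
    ≡⟨ cong ((n C i) ℕ.* ((n ∸ i) C k) ℕ.*_) D′≡D ⟩
  (n C i) ℕ.* ((n ∸ i) C k) ℕ.* D ∎)
  where
  D = k ! ℕ.* (i ! ℕ.* (n ∸ k ∸ i) !)
  D≢0 : ℕ.NonZero D
  D≢0 = ℕₚ.m*n≢0 (k !) _ {{ℕₚ._!≢0 k}} {{ℕₚ._!*_!≢0 i (n ∸ k ∸ i)}}
  i≤n∸k : i ≤ n ∸ k
  i≤n∸k = subst (_≤ n ∸ k) (ℕₚ.m+n∸m≡n k i) (ℕₚ.∸-monoˡ-≤ k k+i≤n)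
  k≤n∸i : k ≤ n ∸ i
  k≤n∸i = subst (_≤ n ∸ i) (ℕₚ.m+n∸n≡m k i) (ℕₚ.∸-monoˡ-≤ i k+i≤n)
  n∸i∸k≡n∸k∸i : n ∸ i ∸ k ≡ n ∸ k ∸ i
  n∸i∸k≡n∸k∸i = trans (ℕₚ.∸-+-assoc n i k) (trans (cong (n ∸_) (ℕₚ.+-comm i k)) (sym (ℕₚ.∸-+-assoc n k i)))
  swap : ∀ p q r → p ℕ.* (q ℕ.* r) ≡ q ℕ.* (p ℕ.* r)
  swap = ℕ-Solver.solve-∀
  D′≡D : i ! ℕ.* (k ! ℕ.* (n ∸ i ∸ k) !) ≡ D
  D′≡D = trans (cong (λ e → i ! ℕ.* (k ! ℕ.* e !)) n∸i∸k≡n∸k∸i) (swap (i !) (k !) ((n ∸ k ∸ i) !))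

binomial : ∀ n z → (z +₅ 1₅) ^₅ n ≡ sumTo n (λ i → fromℕ (n C i) *₅ z ^₅ i)
binomial zero    z = sym (*₅-identityˡ 1₅)
binomial (suc n) z = begin
  (z +₅ 1₅) *₅ (z +₅ 1₅) ^₅ n      ≡⟨ cong ((z +₅ 1₅) *₅_) (binomial n z) ⟩
  (z +₅ 1₅) *₅ P                   ≡⟨ distrib z P ⟩
  z *₅ P +₅ P                      ≡⟨ cong₂ _+₅_ zP≡A P≡1+B ⟩
  A +₅ (1₅ +₅ B)                   ≡⟨ rotate A B ⟩
  1₅ +₅ (A +₅ B)                   ≡⟨ cong (1₅ +₅_) (sym (sumTo-+ n _ _)) ⟩
  1₅ +₅ sumTo n (λ i → fromℕ (n C i) *₅ z ^₅ suc i +₅ fromℕ (n C (suc i)) *₅ z ^₅ suc i)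
                                   ≡⟨ cong (1₅ +₅_) (sumTo-cong n pascal) ⟩
  1₅ +₅ sumTo n (λ i → fromℕ (suc n C suc i) *₅ z ^₅ suc i)
                                   ≡⟨ sumTo-suc n (λ i → fromℕ (suc n C i) *₅ z ^₅ i) ⟨
  sumTo (suc n) (λ i → fromℕ (suc n C i) *₅ z ^₅ i) ∎
  where
  P = sumTo n (λ i → fromℕ (n C i) *₅ z ^₅ i)
  A = sumTo n (λ i → fromℕ (n C i) *₅ z ^₅ suc i)
  B = sumTo n (λ i → fromℕ (n C (suc i)) *₅ z ^₅ suc i)
  distrib : ∀ z p → (z +₅ 1₅) *₅ p ≡ z *₅ p +₅ p
  distrib = solve-∀ Q5-ring
  rotate : ∀ a c → a +₅ (1₅ +₅ c) ≡ 1₅ +₅ (a +₅ c)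
  rotate = solve-∀ Q5-ring
  zP≡A : z *₅ P ≡ A
  zP≡A = trans (sym (sumTo-*ˡ n z _)) (sumTo-cong n λ i → swap z (fromℕ (n C i)) (z ^₅ i))
    where
    swap : ∀ z c w → z *₅ (c *₅ w) ≡ c *₅ (z *₅ w)
    swap = solve-∀ Q5-ring
  P≡1+B : P ≡ 1₅ +₅ B
  P≡1+B = begin
    P                                               ≡⟨ sumTo-extend P-term (ℕₚ.n≤1+n n) vanish ⟨
    sumTo (suc n) P-term                            ≡⟨ sumTo-suc n P-term ⟩
    fromℕ (n C 0) *₅ 1₅ +₅ B                        ≡⟨ cong (_+₅ B) (*₅-identityʳ 1₅) ⟩
    1₅ +₅ B                                         ∎
    where
    P-term : ℕ → Q5
    P-term i = fromℕ (n C i) *₅ z ^₅ i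
    vanish : ∀ i → n < i → P-term i ≡ 0₅
    vanish i n<i = trans (cong (λ c → fromℕ c *₅ z ^₅ i) (k>n⇒nCk≡0 n<i)) (*₅-zeroˡ (z ^₅ i))
  pascal : ∀ i → fromℕ (n C i) *₅ z ^₅ suc i +₅ fromℕ (n C (suc i)) *₅ z ^₅ suc i
                 ≡ fromℕ (suc n C suc i) *₅ z ^₅ suc i
  pascal i = trans (distribʳ (z ^₅ suc i) (fromℕ (n C i)) (fromℕ (n C (suc i))))
    (cong (_*₅ z ^₅ suc i) (trans (sym (fromℕ-+ (n C i) (n C (suc i))))
                                  (cong fromℕ (nCk+nC[k+1]≡[n+1]C[k+1] n i))))
    where
    distribʳ : ∀ x a c → a *₅ x +₅ c *₅ x ≡ (a +₅ c) *₅ x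
    distribʳ = solve-∀ Q5-ring

binomialSum-reverse : ∀ n z (u : ℕ → Q5) →
  sumTo n (λ i → fromℕ (n C i) *₅ z ^₅ i *₅ u (n ∸ i)) ≡ sumTo n (λ k → fromℕ (n C k) *₅ u k *₅ z ^₅ (n ∸ k))
binomialSum-reverse n z u = trans (sumTo-reverse n _) (sumTo-cong≤ n λ k k≤n →
  trans (cong₂ (λ c j → fromℕ c *₅ z ^₅ (n ∸ k) *₅ u j) (sym (nCk≡nC[n∸k] k≤n)) (ℕₚ.m∸[m∸n]≡n k≤n))
        (swap (fromℕ (n C k)) (z ^₅ (n ∸ k)) (u k)))
  where
  swap : ∀ a c d → a *₅ c *₅ d ≡ a *₅ d *₅ c
  swap = solve-∀ Q5-ring

bern : ℕ → Q5
bern k = fromℚ (Bern k)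

nth-++-∷ʳ : ∀ (xs : List ℚ) y {k} → k < length xs → nth (xs ++ [ y ]) k ≡ nth xs k
nth-++-∷ʳ (x ∷ xs) y {zero}  _         = refl
nth-++-∷ʳ (x ∷ xs) y {suc k} (s≤s k<n) = nth-++-∷ʳ xs y k<n

nth-length-++-∷ʳ : ∀ (xs : List ℚ) y → nth (xs ++ [ y ]) (length xs) ≡ y
nth-length-++-∷ʳ []       y = refl
nth-length-++-∷ʳ (x ∷ xs) y = nth-length-++-∷ʳ xs y

length-bernList : ∀ n → length (bernList n) ≡ n
length-bernList zero    = refl
length-bernList (suc n) =
  trans (Listₚ.length-++ (bernList n)) (trans (cong (ℕ._+ 1) (length-bernList n)) (ℕₚ.+-comm n 1))

nth-bernList : ∀ n {k} → k < n → nth (bernList n) k ≡ Bern k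
nth-bernList (suc n) {k} k<1+n with ℕₚ.m<1+n⇒m<n∨m≡n k<1+n
... | inj₁ k<n  = trans (nth-++-∷ʳ (bernList n) (Bern n) (subst (k <_) (sym (length-bernList n)) k<n))
                        (nth-bernList n k<n)
... | inj₂ refl = subst (λ i → nth (bernList (suc k)) i ≡ Bern k) (length-bernList k)
                        (nth-length-++-∷ʳ (bernList k) (Bern k))

sumℚ<-cong : ∀ n {f g : ℕ → ℚ} → (∀ k → k < n → f k ≡ g k) → sumℚ< n f ≡ sumℚ< n g
sumℚ<-cong zero    f≗g = refl
sumℚ<-cong (suc n) f≗g = cong₂ ℚ._+_ (sumℚ<-cong n (λ k k<n → f≗g k (ℕₚ.m<n⇒m<1+n k<n))) (f≗g n ℕₚ.≤-refl)

sumTo-fromℚ : ∀ n (g : ℕ → ℚ) → sumTo n (λ k → fromℚ (g k)) ≡ fromℚ (sumℚ< (suc n) g)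
sumTo-fromℚ zero    g = cong fromℚ (sym (ℚₚ.+-identityˡ (g 0)))
sumTo-fromℚ (suc n) g = cong (_+₅ fromℚ (g (suc n))) (sumTo-fromℚ n g)

[1+n]Cn≡1+n : ∀ n → suc n C n ≡ suc n
[1+n]Cn≡1+n n = trans (nCk≡nC[n∸k] (ℕₚ.n≤1+n n)) (trans (cong (suc n C_) (ℕₚ.m+n∸n≡m 1 n)) (nC1≡n (suc n)))

Bern-recurrenceℚ : ∀ n → sumℚ< (suc n) (λ k → ι (suc n C k) ℚ.* Bern k) ≡ δ0 n
Bern-recurrenceℚ n = begin
  S ℚ.+ ι (suc n C n) ℚ.* Bern n          ≡⟨ cong (λ c → S ℚ.+ ι c ℚ.* Bern n) ([1+n]Cn≡1+n n) ⟩
  S ℚ.+ ι (suc n) ℚ.* ((δ0 n ℚ.- S′) ℚ.* r) ≡⟨ cong (λ x → S ℚ.+ ι (suc n) ℚ.* ((δ0 n ℚ.- x) ℚ.* r)) S′≡S ⟩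
  S ℚ.+ ι (suc n) ℚ.* ((δ0 n ℚ.- S) ℚ.* r)  ≡⟨ regroup S (δ0 n) (ι (suc n)) r ⟩
  S ℚ.+ (δ0 n ℚ.- S) ℚ.* (ι (suc n) ℚ.* r)  ≡⟨ cong (λ x → S ℚ.+ (δ0 n ℚ.- S) ℚ.* x) (ι[1+n]*1/[1+n]≡1 n) ⟩
  S ℚ.+ (δ0 n ℚ.- S) ℚ.* 1ℚ                 ≡⟨ cancel S (δ0 n) ⟩
  δ0 n                                      ∎
  where
  S  = sumℚ< n (λ k → ι (suc n C k) ℚ.* Bern k)
  S′ = sumℚ< n (λ k → ι (suc n C k) ℚ.* nth (bernList n) k)
  r  = + 1 ℚ./ suc n
  S′≡S : S′ ≡ S
  S′≡S = sumℚ<-cong n (λ k k<n → cong (ι (suc n C k) ℚ.*_) (nth-bernList n k<n))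
  regroup : ∀ s d i r → s ℚ.+ i ℚ.* ((d ℚ.- s) ℚ.* r) ≡ s ℚ.+ (d ℚ.- s) ℚ.* (i ℚ.* r)
  regroup = solve-∀ ℚ-ring
  cancel : ∀ s d → s ℚ.+ (d ℚ.- s) ℚ.* 1ℚ ≡ d
  cancel = solve-∀ ℚ-ring

Bern-recurrence : ∀ n → sumTo n (λ k → fromℕ (suc n C k) *₅ bern k) ≡ fromℚ (δ0 n)
Bern-recurrence n = begin
  sumTo n (λ k → fromℕ (suc n C k) *₅ bern k)
    ≡⟨ sumTo-cong n (λ k → sym (fromℚ-* (ι (suc n C k)) (Bern k))) ⟩
  sumTo n (λ k → fromℚ (ι (suc n C k) ℚ.* Bern k))
    ≡⟨ sumTo-fromℚ n (λ k → ι (suc n C k) ℚ.* Bern k) ⟩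
  fromℚ (sumℚ< (suc n) (λ k → ι (suc n C k) ℚ.* Bern k))
    ≡⟨ cong fromℚ (Bern-recurrenceℚ n) ⟩
  fromℚ (δ0 n) ∎

δ1 : ℕ → Q5
δ1 1 = 1₅
δ1 _ = 0₅

sumTo-δ1 : ∀ n (h : ℕ → Q5) → sumTo (suc n) (λ k → δ1 k *₅ h k) ≡ h 1
sumTo-δ1 zero    h = first-vanishes (h 0) (h 1)
  where
  first-vanishes : ∀ x y → 0₅ *₅ x +₅ 1₅ *₅ y ≡ y
  first-vanishes = solve-∀ Q5-ring
sumTo-δ1 (suc n) h = trans (cong₂ _+₅_ (sumTo-δ1 n h) (*₅-zeroˡ (h (suc (suc n))))) (+₅-identityʳ (h 1))

-- The left-hand side is Bₙ(1).
Bern-sum : ∀ n → sumTo n (λ k → fromℕ (n C k) *₅ bern k) ≡ bern n +₅ δ1 n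
Bern-sum zero    = unit-coefficient (bern 0)
  where
  unit-coefficient : ∀ x → 1₅ *₅ x ≡ x +₅ 0₅
  unit-coefficient = solve-∀ Q5-ring
Bern-sum (suc n) = begin
  sumTo n (λ k → fromℕ (suc n C k) *₅ bern k) +₅ fromℕ (suc n C suc n) *₅ bern (suc n)
    ≡⟨ cong₂ _+₅_ (trans (Bern-recurrence n) (δ0≡δ1 n)) (cong (λ c → fromℕ c *₅ bern (suc n)) (nCn≡1 (suc n))) ⟩
  δ1 (suc n) +₅ 1₅ *₅ bern (suc n)
    ≡⟨ swap (δ1 (suc n)) (bern (suc n)) ⟩
  bern (suc n) +₅ δ1 (suc n) ∎
  where
  δ0≡δ1 : ∀ n → fromℚ (δ0 n) ≡ δ1 (suc n)
  δ0≡δ1 zero    = refl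
  δ0≡δ1 (suc n) = refl
  swap : ∀ x y → x +₅ 1₅ *₅ y ≡ y +₅ x
  swap = solve-∀ Q5-ring

δ1-binomialSum : ∀ n z → sumTo n (λ k → fromℕ (n C k) *₅ δ1 k *₅ z ^₅ (n ∸ k)) ≡ fromℕ n *₅ z ^₅ (n ∸ 1)
δ1-binomialSum zero    z = refl
δ1-binomialSum (suc n) z = begin
  sumTo (suc n) (λ k → fromℕ (suc n C k) *₅ δ1 k *₅ z ^₅ (suc n ∸ k))
    ≡⟨ sumTo-cong (suc n) (λ k → swap (fromℕ (suc n C k)) (δ1 k) (z ^₅ (suc n ∸ k))) ⟩
  sumTo (suc n) (λ k → δ1 k *₅ (fromℕ (suc n C k) *₅ z ^₅ (suc n ∸ k)))
    ≡⟨ sumTo-δ1 n _ ⟩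
  fromℕ (suc n C 1) *₅ z ^₅ n
    ≡⟨ cong (λ c → fromℕ c *₅ z ^₅ n) (nC1≡n (suc n)) ⟩
  fromℕ (suc n) *₅ z ^₅ n ∎
  where
  swap : ∀ x y w → x *₅ y *₅ w ≡ y *₅ (x *₅ w)
  swap = solve-∀ Q5-ring

BernPoly-+1 : ∀ n z → BernPoly n (z +₅ 1₅) ≡ BernPoly n z +₅ fromℕ n *₅ z ^₅ (n ∸ 1)
BernPoly-+1 n z = begin
  sumTo n (λ k → fromℕ (n C k) *₅ bern k *₅ (z +₅ 1₅) ^₅ (n ∸ k))
    ≡⟨ sumTo-cong≤ n expand ⟩
  sumTo n (λ k → sumTo n (g k))
    ≡⟨ sumTo-swap n n g ⟩
  sumTo n (λ i → sumTo n (λ k → g k i))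
    ≡⟨ sumTo-cong≤ n collect ⟩
  sumTo n (λ i → c i *₅ bern (n ∸ i) +₅ c i *₅ δ1 (n ∸ i))
    ≡⟨ sumTo-+ n (λ i → c i *₅ bern (n ∸ i)) (λ i → c i *₅ δ1 (n ∸ i)) ⟩
  sumTo n (λ i → c i *₅ bern (n ∸ i)) +₅ sumTo n (λ i → c i *₅ δ1 (n ∸ i))
    ≡⟨ cong₂ _+₅_ (binomialSum-reverse n z bern)
                  (trans (binomialSum-reverse n z δ1) (δ1-binomialSum n z)) ⟩
  BernPoly n z +₅ fromℕ n *₅ z ^₅ (n ∸ 1) ∎
  where
  c : ℕ → Q5
  c i = fromℕ (n C i) *₅ z ^₅ i
  g : ℕ → ℕ → Q5
  g k i = fromℕ (n C k) *₅ fromℕ ((n ∸ k) C i) *₅ bern k *₅ z ^₅ i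
  expand : ∀ k → k ≤ n → fromℕ (n C k) *₅ bern k *₅ (z +₅ 1₅) ^₅ (n ∸ k) ≡ sumTo n (g k)
  expand k k≤n = begin
    fromℕ (n C k) *₅ bern k *₅ (z +₅ 1₅) ^₅ (n ∸ k)
      ≡⟨ cong (fromℕ (n C k) *₅ bern k *₅_) (binomial (n ∸ k) z) ⟩
    fromℕ (n C k) *₅ bern k *₅ sumTo (n ∸ k) (λ i → fromℕ ((n ∸ k) C i) *₅ z ^₅ i)
      ≡⟨ sumTo-*ˡ (n ∸ k) (fromℕ (n C k) *₅ bern k) _ ⟨
    sumTo (n ∸ k) (λ i → fromℕ (n C k) *₅ bern k *₅ (fromℕ ((n ∸ k) C i) *₅ z ^₅ i))
      ≡⟨ sumTo-cong (n ∸ k) (λ i → regroup (fromℕ (n C k)) (bern k) (fromℕ ((n ∸ k) C i)) (z ^₅ i)) ⟩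
    sumTo (n ∸ k) (g k)
      ≡⟨ sumTo-extend (g k) (ℕₚ.m∸n≤m n k) vanish ⟨
    sumTo n (g k) ∎
    where
    regroup : ∀ a b c w → a *₅ b *₅ (c *₅ w) ≡ a *₅ c *₅ b *₅ w
    regroup = solve-∀ Q5-ring
    vanish : ∀ i → n ∸ k < i → g k i ≡ 0₅
    vanish i n∸k<i = trans (cong (λ d → fromℕ (n C k) *₅ fromℕ d *₅ bern k *₅ z ^₅ i) (k>n⇒nCk≡0 n∸k<i))
                           (zero-factor (fromℕ (n C k)) (bern k) (z ^₅ i))
      where
      zero-factor : ∀ a b w → a *₅ 0₅ *₅ b *₅ w ≡ 0₅
      zero-factor = solve-∀ Q5-ring
  collect : ∀ i → i ≤ n → sumTo n (λ k → g k i) ≡ c i *₅ bern (n ∸ i) +₅ c i *₅ δ1 (n ∸ i)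
  collect i i≤n = begin
    sumTo n (λ k → g k i)
      ≡⟨ sumTo-cong n swap-choices ⟩
    sumTo n (λ k → c i *₅ (fromℕ ((n ∸ i) C k) *₅ bern k))
      ≡⟨ sumTo-*ˡ n (c i) _ ⟩
    c i *₅ sumTo n (λ k → fromℕ ((n ∸ i) C k) *₅ bern k)
      ≡⟨ cong (c i *₅_) (sumTo-extend _ (ℕₚ.m∸n≤m n i) vanish) ⟩
    c i *₅ sumTo (n ∸ i) (λ k → fromℕ ((n ∸ i) C k) *₅ bern k)
      ≡⟨ cong (c i *₅_) (Bern-sum (n ∸ i)) ⟩
    c i *₅ (bern (n ∸ i) +₅ δ1 (n ∸ i))
      ≡⟨ *₅-distribˡ (c i) _ _ ⟩
    c i *₅ bern (n ∸ i) +₅ c i *₅ δ1 (n ∸ i) ∎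
    where
    regroup : ∀ a b c w → a *₅ c *₅ w *₅ b ≡ (a *₅ b) *₅ (c *₅ w)
    regroup = solve-∀ Q5-ring
    swap-choices : ∀ k → g k i ≡ c i *₅ (fromℕ ((n ∸ i) C k) *₅ bern k)
    swap-choices k = trans
      (cong (λ x → x *₅ bern k *₅ z ^₅ i)
        (trans (sym (fromℕ-* (n C k) ((n ∸ k) C i)))
               (trans (cong fromℕ (nCk*[n∸k]Ci≡nCi*[n∸i]Ck n k i)) (fromℕ-* (n C i) ((n ∸ i) C k)))))
      (regroup (fromℕ (n C i)) (z ^₅ i) (fromℕ ((n ∸ i) C k)) (bern k))
    vanish : ∀ k → n ∸ i < k → fromℕ ((n ∸ i) C k) *₅ bern k ≡ 0₅
    vanish k n∸i<k = trans (cong (λ d → fromℕ d *₅ bern k) (k>n⇒nCk≡0 n∸i<k)) (*₅-zeroˡ (bern k))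

BernPoly-0 : ∀ n → BernPoly n 0₅ ≡ bern n
BernPoly-0 zero    = unit-factors (bern 0)
  where
  unit-factors : ∀ x → 1₅ *₅ x *₅ 1₅ ≡ x
  unit-factors = solve-∀ Q5-ring
BernPoly-0 (suc n) = begin
  BernPoly (suc n) 0₅
    ≡⟨ binomialSum-reverse (suc n) 0₅ bern ⟨
  sumTo (suc n) (λ i → fromℕ (suc n C i) *₅ 0₅ ^₅ i *₅ bern (suc n ∸ i))
    ≡⟨ sumTo-suc n _ ⟩
  fromℕ 1 *₅ 1₅ *₅ bern (suc n) +₅ sumTo n (λ i → fromℕ (suc n C suc i) *₅ (0₅ *₅ 0₅ ^₅ i) *₅ bern (n ∸ i))
    ≡⟨ cong₂ _+₅_ (unit-factors (bern (suc n)))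
                  (sumTo-zero n _ λ i → zero-factor (fromℕ (suc n C suc i)) (0₅ ^₅ i) (bern (n ∸ i))) ⟩
  bern (suc n) +₅ 0₅
    ≡⟨ +₅-identityʳ (bern (suc n)) ⟩
  bern (suc n) ∎
  where
  unit-factors : ∀ x → 1₅ *₅ 1₅ *₅ x ≡ x
  unit-factors = solve-∀ Q5-ring
  zero-factor : ∀ a w b → a *₅ (0₅ *₅ w) *₅ b ≡ 0₅
  zero-factor = solve-∀ Q5-ring

BernPoly-neg-expand : ∀ n z →
  BernPoly n (-₅ z) ≡ sgn n *₅ sumTo n (λ k → fromℕ (n C k) *₅ (sgn k *₅ bern k) *₅ z ^₅ (n ∸ k))
BernPoly-neg-expand n z = trans (sumTo-cong≤ n pull-sign) (sumTo-*ˡ n (sgn n) _)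
  where
  regroup : ∀ c b s t w → c *₅ b *₅ ((s *₅ t) *₅ w) ≡ s *₅ (c *₅ (t *₅ b) *₅ w)
  regroup = solve-∀ Q5-ring
  pull-sign : ∀ k → k ≤ n → fromℕ (n C k) *₅ bern k *₅ (-₅ z) ^₅ (n ∸ k)
                            ≡ sgn n *₅ (fromℕ (n C k) *₅ (sgn k *₅ bern k) *₅ z ^₅ (n ∸ k))
  pull-sign k k≤n = begin
    fromℕ (n C k) *₅ bern k *₅ (-₅ z) ^₅ (n ∸ k)
      ≡⟨ cong (fromℕ (n C k) *₅ bern k *₅_) (-₅-^₅ z (n ∸ k)) ⟩
    fromℕ (n C k) *₅ bern k *₅ (sgn (n ∸ k) *₅ z ^₅ (n ∸ k))
      ≡⟨ cong (λ s → fromℕ (n C k) *₅ bern k *₅ (s *₅ z ^₅ (n ∸ k))) (sgn-∸ n k k≤n) ⟩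
    fromℕ (n C k) *₅ bern k *₅ ((sgn n *₅ sgn k) *₅ z ^₅ (n ∸ k))
      ≡⟨ regroup (fromℕ (n C k)) (bern k) (sgn n) (sgn k) (z ^₅ (n ∸ k)) ⟩
    sgn n *₅ (fromℕ (n C k) *₅ (sgn k *₅ bern k) *₅ z ^₅ (n ∸ k)) ∎

BernPoly-at-−1 : ∀ n → BernPoly (suc n) (-₅ 1₅)
  ≡ sgn (suc n) *₅ (sumTo n (λ k → fromℕ (suc n C k) *₅ (sgn k *₅ bern k)) +₅ sgn (suc n) *₅ bern (suc n))
BernPoly-at-−1 n = begin
  BernPoly N (-₅ 1₅)
    ≡⟨ BernPoly-neg-expand N 1₅ ⟩
  sgn N *₅ sumTo N (λ k → fromℕ (N C k) *₅ (sgn k *₅ bern k) *₅ 1₅ ^₅ (N ∸ k))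
    ≡⟨ cong (sgn N *₅_) (sumTo-cong N drop-power) ⟩
  sgn N *₅ (W +₅ fromℕ (N C N) *₅ (sgn N *₅ bern N))
    ≡⟨ cong (λ c → sgn N *₅ (W +₅ fromℕ c *₅ (sgn N *₅ bern N))) (nCn≡1 N) ⟩
  sgn N *₅ (W +₅ 1₅ *₅ (sgn N *₅ bern N))
    ≡⟨ cong (λ x → sgn N *₅ (W +₅ x)) (*₅-identityˡ (sgn N *₅ bern N)) ⟩
  sgn N *₅ (W +₅ sgn N *₅ bern N) ∎
  where
  N = suc n
  W = sumTo n (λ k → fromℕ (N C k) *₅ (sgn k *₅ bern k))
  drop-power : ∀ k → fromℕ (N C k) *₅ (sgn k *₅ bern k) *₅ 1₅ ^₅ (N ∸ k) ≡ fromℕ (N C k) *₅ (sgn k *₅ bern k)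
  drop-power k = trans (cong (fromℕ (N C k) *₅ (sgn k *₅ bern k) *₅_) (1^₅n≡1 (N ∸ k))) (*₅-identityʳ _)

alternatingBern-recurrence : ∀ n → sumTo n (λ k → fromℕ (suc n C k) *₅ (sgn k *₅ bern k)) ≡ fromℕ (suc n)
alternatingBern-recurrence n = begin
  W                         ≡⟨ subtract-twice W N ⟩
  N -₅ (N -₅ W)             ≡⟨ cong (λ x → N -₅ x) N-W≡0 ⟩
  N -₅ 0₅                   ≡⟨ +₅-identityʳ N ⟩
  N                         ∎
  where
  N = fromℕ (suc n)
  s = sgn n
  b = bern (suc n)
  W = sumTo n (λ k → fromℕ (suc n C k) *₅ (sgn k *₅ bern k))
  R = sgn (suc n) *₅ (W +₅ sgn (suc n) *₅ b) +₅ N *₅ s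
  b≡R : b ≡ R
  b≡R = begin
    b                                    ≡⟨ BernPoly-0 (suc n) ⟨
    BernPoly (suc n) 0₅                  ≡⟨ BernPoly-+1 (suc n) (-₅ 1₅) ⟩
    BernPoly (suc n) (-₅ 1₅) +₅ N *₅ s   ≡⟨ cong (_+₅ N *₅ s) (BernPoly-at-−1 n) ⟩
    R                                    ∎
  -- sgn (suc n) unfolds to (-1) · s, and s² = 1.
  N-W≡0 : N -₅ W ≡ 0₅
  N-W≡0 = begin
    N -₅ W                                        ≡⟨ *₅-identityˡ (N -₅ W) ⟨
    1₅ *₅ (N -₅ W)                                ≡⟨ cong (_*₅ (N -₅ W)) (sgn*sgn≡1 n) ⟨
    (s *₅ s) *₅ (N -₅ W)                          ≡⟨ isolate s b W N ⟩
    s *₅ (R -₅ b) -₅ (s *₅ s -₅ 1₅) *₅ (s *₅ b)   ≡⟨ cong₂ (λ x y → s *₅ (x -₅ b) -₅ (y -₅ 1₅) *₅ (s *₅ b))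
                                                           (sym b≡R) (sgn*sgn≡1 n) ⟩
    s *₅ (b -₅ b) -₅ (1₅ -₅ 1₅) *₅ (s *₅ b)       ≡⟨ vanishes s b ⟩
    0₅                                            ∎
    where
    isolate : ∀ s b W N → (s *₅ s) *₅ (N -₅ W)
      ≡ s *₅ ((((-₅ 1₅) *₅ s) *₅ (W +₅ ((-₅ 1₅) *₅ s) *₅ b) +₅ N *₅ s) -₅ b) -₅ (s *₅ s -₅ 1₅) *₅ (s *₅ b)
    isolate = solve-∀ Q5-ring
    vanishes : ∀ s b → s *₅ (b -₅ b) -₅ (1₅ -₅ 1₅) *₅ (s *₅ b) ≡ 0₅
    vanishes = solve-∀ Q5-ring
  subtract-twice : ∀ W N → W ≡ N -₅ (N -₅ W)
  subtract-twice = solve-∀ Q5-ring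

Bern-unique : (c : ℕ → Q5) → (∀ n → sumTo n (λ k → fromℕ (suc n C k) *₅ c k) ≡ fromℚ (δ0 n)) →
              ∀ n → c n ≡ bern n
Bern-unique c c-recurrence = <-rec (λ n → c n ≡ bern n) step
  where
  step : ∀ n → (∀ {k} → k < n → c k ≡ bern k) → c n ≡ bern n
  step zero    _  = fromℕ-suc-cancelˡ 0 (trans (c-recurrence 0) (sym (Bern-recurrence 0)))
  step (suc n) IH = fromℕ-suc-cancelˡ (suc n) (+₅-cancelˡ (S bern) (begin
    S bern +₅ fromℕ (suc (suc n)) *₅ c (suc n)               ≡⟨ cong (_+₅ fromℕ (suc (suc n)) *₅ c (suc n)) S≡S ⟨
    S c +₅ fromℕ (suc (suc n)) *₅ c (suc n)                  ≡⟨ last-coefficient c ⟨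
    sumTo (suc n) (λ k → fromℕ (suc (suc n) C k) *₅ c k)     ≡⟨ c-recurrence (suc n) ⟩
    fromℚ (δ0 (suc n))                                       ≡⟨ Bern-recurrence (suc n) ⟨
    sumTo (suc n) (λ k → fromℕ (suc (suc n) C k) *₅ bern k)  ≡⟨ last-coefficient bern ⟩
    S bern +₅ fromℕ (suc (suc n)) *₅ bern (suc n)            ∎))
    where
    S : (ℕ → Q5) → Q5
    S d = sumTo n (λ k → fromℕ (suc (suc n) C k) *₅ d k)
    last-coefficient : ∀ d → sumTo (suc n) (λ k → fromℕ (suc (suc n) C k) *₅ d k)
                             ≡ S d +₅ fromℕ (suc (suc n)) *₅ d (suc n)
    last-coefficient d = cong (λ m → S d +₅ fromℕ m *₅ d (suc n)) ([1+n]Cn≡1+n (suc n))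
    S≡S : S c ≡ S bern
    S≡S = sumTo-cong≤ n (λ k k≤n → cong (fromℕ (suc (suc n) C k) *₅_) (IH (s≤s k≤n)))

sgn*bern : ∀ k → sgn k *₅ bern k ≡ bern k +₅ δ1 k
sgn*bern k = trans (shift (sgn k *₅ bern k) (δ1 k)) (cong (_+₅ δ1 k) (Bern-unique c c-recurrence k))
  where
  c : ℕ → Q5
  c k = sgn k *₅ bern k -₅ δ1 k
  shift : ∀ x d → x ≡ (x -₅ d) +₅ d
  shift = solve-∀ Q5-ring
  δ1-sum : ∀ n → sumTo n (λ k → fromℕ (suc n C k) *₅ δ1 k) ≡ fromℕ (suc n) -₅ fromℚ (δ0 n)
  δ1-sum zero    = refl
  δ1-sum (suc n) = begin
    sumTo (suc n) (λ k → fromℕ (suc (suc n) C k) *₅ δ1 k) ≡⟨ sumTo-cong (suc n) (λ k → *₅-comm _ (δ1 k)) ⟩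
    sumTo (suc n) (λ k → δ1 k *₅ fromℕ (suc (suc n) C k)) ≡⟨ sumTo-δ1 n _ ⟩
    fromℕ (suc (suc n) C 1)                               ≡⟨ cong fromℕ (nC1≡n (suc (suc n))) ⟩
    fromℕ (suc (suc n))                                   ≡⟨ +₅-identityʳ _ ⟨
    fromℕ (suc (suc n)) -₅ 0₅                             ∎
  c-recurrence : ∀ n → sumTo n (λ k → fromℕ (suc n C k) *₅ c k) ≡ fromℚ (δ0 n)
  c-recurrence n = begin
    sumTo n (λ k → fromℕ (suc n C k) *₅ c k)
      ≡⟨ sumTo-cong n (λ k → split (fromℕ (suc n C k)) (sgn k *₅ bern k) (δ1 k)) ⟩
    sumTo n (λ k → 1₅ *₅ (fromℕ (suc n C k) *₅ (sgn k *₅ bern k)) +₅ (-₅ 1₅) *₅ (fromℕ (suc n C k) *₅ δ1 k))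
      ≡⟨ sumTo-linear n 1₅ (-₅ 1₅) _ _ ⟩
    1₅ *₅ sumTo n (λ k → fromℕ (suc n C k) *₅ (sgn k *₅ bern k))
      +₅ (-₅ 1₅) *₅ sumTo n (λ k → fromℕ (suc n C k) *₅ δ1 k)
      ≡⟨ cong₂ (λ x y → 1₅ *₅ x +₅ (-₅ 1₅) *₅ y) (alternatingBern-recurrence n) (δ1-sum n) ⟩
    1₅ *₅ fromℕ (suc n) +₅ (-₅ 1₅) *₅ (fromℕ (suc n) -₅ fromℚ (δ0 n))
      ≡⟨ cancel (fromℕ (suc n)) (fromℚ (δ0 n)) ⟩
    fromℚ (δ0 n) ∎
    where
    split : ∀ a x d → a *₅ (x -₅ d) ≡ 1₅ *₅ (a *₅ x) +₅ (-₅ 1₅) *₅ (a *₅ d)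
    split = solve-∀ Q5-ring
    cancel : ∀ N d → 1₅ *₅ N +₅ (-₅ 1₅) *₅ (N -₅ d) ≡ d
    cancel = solve-∀ Q5-ring

BernPoly-neg : ∀ n z → BernPoly n (-₅ z) ≡ sgn n *₅ (BernPoly n z +₅ fromℕ n *₅ z ^₅ (n ∸ 1))
BernPoly-neg n z = begin
  BernPoly n (-₅ z)
    ≡⟨ BernPoly-neg-expand n z ⟩
  sgn n *₅ sumTo n (λ k → fromℕ (n C k) *₅ (sgn k *₅ bern k) *₅ z ^₅ (n ∸ k))
    ≡⟨ cong (sgn n *₅_) (sumTo-cong n split) ⟩
  sgn n *₅ sumTo n (λ k → fromℕ (n C k) *₅ bern k *₅ z ^₅ (n ∸ k) +₅ fromℕ (n C k) *₅ δ1 k *₅ z ^₅ (n ∸ k))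
    ≡⟨ cong (sgn n *₅_) (sumTo-+ n _ _) ⟩
  sgn n *₅ (BernPoly n z +₅ sumTo n (λ k → fromℕ (n C k) *₅ δ1 k *₅ z ^₅ (n ∸ k)))
    ≡⟨ cong (λ x → sgn n *₅ (BernPoly n z +₅ x)) (δ1-binomialSum n z) ⟩
  sgn n *₅ (BernPoly n z +₅ fromℕ n *₅ z ^₅ (n ∸ 1)) ∎
  where
  distrib : ∀ a x d w → a *₅ (x +₅ d) *₅ w ≡ a *₅ x *₅ w +₅ a *₅ d *₅ w
  distrib = solve-∀ Q5-ring
  split : ∀ k → fromℕ (n C k) *₅ (sgn k *₅ bern k) *₅ z ^₅ (n ∸ k)
                ≡ fromℕ (n C k) *₅ bern k *₅ z ^₅ (n ∸ k) +₅ fromℕ (n C k) *₅ δ1 k *₅ z ^₅ (n ∸ k)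
  split k = trans (cong (λ x → fromℕ (n C k) *₅ x *₅ z ^₅ (n ∸ k)) (sgn*bern k))
                  (distrib (fromℕ (n C k)) (bern k) (δ1 k) (z ^₅ (n ∸ k)))

BernPoly-reflect : ∀ n t → BernPoly n (1₅ -₅ t) ≡ sgn n *₅ BernPoly n t
BernPoly-reflect n t = begin
  BernPoly n (1₅ -₅ t)                                 ≡⟨ cong (BernPoly n) (negate t) ⟩
  BernPoly n (-₅ w)                                    ≡⟨ BernPoly-neg n w ⟩
  sgn n *₅ (BernPoly n w +₅ fromℕ n *₅ w ^₅ (n ∸ 1))   ≡⟨ cong (sgn n *₅_) (BernPoly-+1 n w) ⟨
  sgn n *₅ BernPoly n (w +₅ 1₅)                        ≡⟨ cong (λ x → sgn n *₅ BernPoly n x) (restore t) ⟩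
  sgn n *₅ BernPoly n t                                ∎
  where
  w = t -₅ 1₅
  negate : ∀ t → 1₅ -₅ t ≡ -₅ (t -₅ 1₅)
  negate = solve-∀ Q5-ring
  restore : ∀ t → (t -₅ 1₅) +₅ 1₅ ≡ t
  restore = solve-∀ Q5-ring

alternatingBernSum : ∀ n t u v →
  sumTo n (λ k → sgn k *₅ fromℕ (n C k) *₅ (u *₅ t ^₅ k +₅ v *₅ (1₅ -₅ t) ^₅ k) *₅ bern (n ∸ k))
    ≡ sgn n *₅ ((u +₅ sgn n *₅ v) *₅ BernPoly n t
                +₅ fromℕ n *₅ (u *₅ t ^₅ (n ∸ 1) +₅ v *₅ (1₅ -₅ t) ^₅ (n ∸ 1)))
alternatingBernSum n t u v = begin
  sumTo n (λ k → sgn k *₅ fromℕ (n C k) *₅ (u *₅ t ^₅ k +₅ v *₅ s ^₅ k) *₅ bern (n ∸ k))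
    ≡⟨ sumTo-cong n split ⟩
  sumTo n (λ k → u *₅ A t k +₅ v *₅ A s k)
    ≡⟨ sumTo-linear n u v (A t) (A s) ⟩
  u *₅ sumTo n (A t) +₅ v *₅ sumTo n (A s)
    ≡⟨ cong₂ (λ x y → u *₅ x +₅ v *₅ y) (sum-A t) (trans (sum-A s) reflect) ⟩
  u *₅ (sgn n *₅ (BernPoly n t +₅ fromℕ n *₅ t ^₅ (n ∸ 1)))
    +₅ v *₅ (sgn n *₅ (sgn n *₅ BernPoly n t +₅ fromℕ n *₅ s ^₅ (n ∸ 1)))
    ≡⟨ collect u v (sgn n) (BernPoly n t) (fromℕ n) (t ^₅ (n ∸ 1)) (s ^₅ (n ∸ 1)) ⟩
  sgn n *₅ ((u +₅ sgn n *₅ v) *₅ BernPoly n t +₅ fromℕ n *₅ (u *₅ t ^₅ (n ∸ 1) +₅ v *₅ s ^₅ (n ∸ 1))) ∎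
  where
  s = 1₅ -₅ t
  A : Q5 → ℕ → Q5
  A w k = fromℕ (n C k) *₅ (-₅ w) ^₅ k *₅ bern (n ∸ k)
  sum-A : ∀ w → sumTo n (A w) ≡ sgn n *₅ (BernPoly n w +₅ fromℕ n *₅ w ^₅ (n ∸ 1))
  sum-A w = trans (binomialSum-reverse n (-₅ w) bern) (BernPoly-neg n w)
  reflect : sgn n *₅ (BernPoly n s +₅ fromℕ n *₅ s ^₅ (n ∸ 1))
            ≡ sgn n *₅ (sgn n *₅ BernPoly n t +₅ fromℕ n *₅ s ^₅ (n ∸ 1))
  reflect = cong (λ x → sgn n *₅ (x +₅ fromℕ n *₅ s ^₅ (n ∸ 1))) (BernPoly-reflect n t)
  distribute : ∀ σ c u x v y b →
    σ *₅ c *₅ (u *₅ x +₅ v *₅ y) *₅ b ≡ u *₅ (c *₅ (σ *₅ x) *₅ b) +₅ v *₅ (c *₅ (σ *₅ y) *₅ b)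
  distribute = solve-∀ Q5-ring
  split : ∀ k → sgn k *₅ fromℕ (n C k) *₅ (u *₅ t ^₅ k +₅ v *₅ s ^₅ k) *₅ bern (n ∸ k)
                ≡ u *₅ A t k +₅ v *₅ A s k
  split k = trans (distribute (sgn k) (fromℕ (n C k)) u (t ^₅ k) v (s ^₅ k) (bern (n ∸ k)))
    (cong₂ (λ x y → u *₅ (fromℕ (n C k) *₅ x *₅ bern (n ∸ k)) +₅ v *₅ (fromℕ (n C k) *₅ y *₅ bern (n ∸ k)))
           (sym (-₅-^₅ t k)) (sym (-₅-^₅ s k)))
  collect : ∀ u v σ B N T S → u *₅ (σ *₅ (B +₅ N *₅ T)) +₅ v *₅ (σ *₅ (σ *₅ B +₅ N *₅ S))
                              ≡ σ *₅ ((u +₅ σ *₅ v) *₅ B +₅ N *₅ (u *₅ T +₅ v *₅ S))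
  collect = solve-∀ Q5-ring

norm : Q5 → ℚ
norm (a ⊕ b √5) = a ℚ.* a ℚ.- five ℚ.* (b ℚ.* b)

norm-* : ∀ x y → norm (x *₅ y) ≡ norm x ℚ.* norm y
norm-* (a ⊕ b √5) (c ⊕ d √5) = multiplicative a b c d five
  where
  multiplicative : ∀ a b c d k →
    (a ℚ.* c ℚ.+ k ℚ.* (b ℚ.* d)) ℚ.* (a ℚ.* c ℚ.+ k ℚ.* (b ℚ.* d))
      ℚ.- k ℚ.* ((a ℚ.* d ℚ.+ b ℚ.* c) ℚ.* (a ℚ.* d ℚ.+ b ℚ.* c))
    ≡ (a ℚ.* a ℚ.- k ℚ.* (b ℚ.* b)) ℚ.* (c ℚ.* c ℚ.- k ℚ.* (d ℚ.* d))
  multiplicative = solve-∀ ℚ-ring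

invℚ-inverseʳ : ∀ p → ¬ p ≡ 0ℚ → p ℚ.* invℚ p ≡ 1ℚ
invℚ-inverseʳ p p≢0 with p ℚₚ.≟ 0ℚ
... | yes p≡0 = ⊥-elim (p≢0 p≡0)
... | no  _   = ℚₚ.*-inverseʳ p {{ℚ.≢-nonZero p≢0}}

inv₅-inverseʳ : ∀ x → ¬ norm x ≡ 0ℚ → x *₅ inv₅ x ≡ 1₅
inv₅-inverseʳ (a ⊕ b √5) N≢0 =
  ⊕-cong (trans (re-part a b five (invℚ N)) (invℚ-inverseʳ N N≢0)) (im-part a b (invℚ N))
  where
  N = a ℚ.* a ℚ.- five ℚ.* (b ℚ.* b)
  re-part : ∀ a b k i → a ℚ.* (a ℚ.* i) ℚ.+ k ℚ.* (b ℚ.* (ℚ.- (b ℚ.* i))) ≡ (a ℚ.* a ℚ.- k ℚ.* (b ℚ.* b)) ℚ.* i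
  re-part = solve-∀ ℚ-ring
  im-part : ∀ a b i → a ℚ.* (ℚ.- (b ℚ.* i)) ℚ.+ b ℚ.* (a ℚ.* i) ≡ 0ℚ
  im-part = solve-∀ ℚ-ring

inv₅-unique : ∀ x y → x *₅ y ≡ 1₅ → inv₅ x ≡ y
inv₅-unique x y x*y≡1 = begin
  inv₅ x                     ≡⟨ *₅-identityʳ (inv₅ x) ⟨
  inv₅ x *₅ 1₅               ≡⟨ cong (inv₅ x *₅_) x*y≡1 ⟨
  inv₅ x *₅ (x *₅ y)         ≡⟨ regroup (inv₅ x) x y ⟩
  (x *₅ inv₅ x) *₅ y         ≡⟨ cong (_*₅ y) (inv₅-inverseʳ x norm≢0) ⟩
  1₅ *₅ y                    ≡⟨ *₅-identityˡ y ⟩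
  y                          ∎
  where
  regroup : ∀ i x y → i *₅ (x *₅ y) ≡ (x *₅ i) *₅ y
  regroup = solve-∀ Q5-ring
  norm≢0 : ¬ norm x ≡ 0ℚ
  norm≢0 nx≡0 = ℚₚ.1≢0 (begin
    1ℚ                       ≡⟨ norm-1₅ ⟨
    norm 1₅                  ≡⟨ cong norm x*y≡1 ⟨
    norm (x *₅ y)            ≡⟨ norm-* x y ⟩
    norm x ℚ.* norm y        ≡⟨ cong (ℚ._* norm y) nx≡0 ⟩
    0ℚ ℚ.* norm y            ≡⟨ ℚₚ.*-zeroˡ (norm y) ⟩
    0ℚ                       ∎)
    where
    norm-1₅ : norm 1₅ ≡ 1ℚ
    norm-1₅ = refl

inv₅-^₅ : ∀ x → x *₅ inv₅ x ≡ 1₅ → ∀ n → inv₅ (x ^₅ n) ≡ inv₅ x ^₅ n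
inv₅-^₅ x x*x⁻¹≡1 n = inv₅-unique (x ^₅ n) (inv₅ x ^₅ n) (begin
  x ^₅ n *₅ inv₅ x ^₅ n      ≡⟨ ^₅-distrib-* x (inv₅ x) n ⟨
  (x *₅ inv₅ x) ^₅ n         ≡⟨ cong (_^₅ n) x*x⁻¹≡1 ⟩
  1₅ ^₅ n                    ≡⟨ 1^₅n≡1 n ⟩
  1₅                         ∎)

module UnitPowers (a : Q5) (a*a⁻¹≡1 : a *₅ inv₅ a ≡ 1₅) where

  ^ℤ-⊖ : ∀ m n → a ^ℤ (m ⊖ n) ≡ a ^₅ m *₅ inv₅ a ^₅ n
  ^ℤ-⊖ m       zero    = sym (*₅-identityʳ (a ^₅ m))
  ^ℤ-⊖ zero    (suc n) = trans (inv₅-^₅ a a*a⁻¹≡1 (suc n)) (sym (*₅-identityˡ _))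
  ^ℤ-⊖ (suc m) (suc n) = begin
    a ^ℤ (suc m ⊖ suc n)                          ≡⟨ cong (a ^ℤ_) (ℤₚ.[1+m]⊖[1+n]≡m⊖n m n) ⟩
    a ^ℤ (m ⊖ n)                                  ≡⟨ ^ℤ-⊖ m n ⟩
    a ^₅ m *₅ inv₅ a ^₅ n                         ≡⟨ *₅-identityˡ _ ⟨
    1₅ *₅ (a ^₅ m *₅ inv₅ a ^₅ n)                 ≡⟨ cong (_*₅ (a ^₅ m *₅ inv₅ a ^₅ n)) a*a⁻¹≡1 ⟨
    (a *₅ inv₅ a) *₅ (a ^₅ m *₅ inv₅ a ^₅ n)      ≡⟨ interchange a (inv₅ a) (a ^₅ m) (inv₅ a ^₅ n) ⟩
    a ^₅ suc m *₅ inv₅ a ^₅ suc n                 ∎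
    where
    interchange : ∀ a e x y → (a *₅ e) *₅ (x *₅ y) ≡ (a *₅ x) *₅ (e *₅ y)
    interchange = solve-∀ Q5-ring

  ^ℤ-+ : ∀ i j → a ^ℤ (i + j) ≡ a ^ℤ i *₅ a ^ℤ j
  ^ℤ-+ (+ m)    (+ n)    = ^₅-+ a m n
  ^ℤ-+ (+ m)    -[1+ n ] = trans (^ℤ-⊖ m (suc n)) (cong (a ^₅ m *₅_) (sym (inv₅-^₅ a a*a⁻¹≡1 (suc n))))
  ^ℤ-+ -[1+ m ] (+ n)    = trans (^ℤ-⊖ n (suc m))
    (trans (*₅-comm (a ^₅ n) _) (cong (_*₅ a ^₅ n) (sym (inv₅-^₅ a a*a⁻¹≡1 (suc m)))))
  ^ℤ-+ -[1+ m ] -[1+ n ] = begin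
    inv₅ (a ^₅ suc (suc (m ℕ.+ n)))                 ≡⟨ inv₅-^₅ a a*a⁻¹≡1 (suc (suc (m ℕ.+ n))) ⟩
    inv₅ a ^₅ suc (suc (m ℕ.+ n))                   ≡⟨ cong (inv₅ a ^₅_) (ℕₚ.+-suc (suc m) n) ⟨
    inv₅ a ^₅ (suc m ℕ.+ suc n)                     ≡⟨ ^₅-+ (inv₅ a) (suc m) (suc n) ⟩
    inv₅ a ^₅ suc m *₅ inv₅ a ^₅ suc n              ≡⟨ cong₂ _*₅_ (inv₅-^₅ a a*a⁻¹≡1 (suc m))
                                                                    (inv₅-^₅ a a*a⁻¹≡1 (suc n)) ⟨
    inv₅ (a ^₅ suc m) *₅ inv₅ (a ^₅ suc n)          ∎

  ^ℤ-*ℕ : ∀ i k → a ^ℤ (i * + k) ≡ (a ^ℤ i) ^₅ k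
  ^ℤ-*ℕ i zero    = cong (a ^ℤ_) (ℤₚ.*-zeroʳ i)
  ^ℤ-*ℕ i (suc k) = begin
    a ^ℤ (i * + suc k)          ≡⟨ cong (a ^ℤ_) (ℤₚ.*-suc i (+ k)) ⟩
    a ^ℤ (i + i * + k)          ≡⟨ ^ℤ-+ i (i * + k) ⟩
    a ^ℤ i *₅ a ^ℤ (i * + k)    ≡⟨ cong (a ^ℤ i *₅_) (^ℤ-*ℕ i k) ⟩
    (a ^ℤ i) ^₅ suc k           ∎

  ^ℤ-affine : ∀ j k m → a ^ℤ (j * + k + m) ≡ (a ^ℤ j) ^₅ k *₅ a ^ℤ m
  ^ℤ-affine j k m = trans (^ℤ-+ (j * + k) m) (cong (_*₅ a ^ℤ m) (^ℤ-*ℕ j k))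

module α^ = UnitPowers α refl
module β^ = UnitPowers β refl

conj : Q5 → Q5
conj (a ⊕ b √5) = a ⊕ (ℚ.- b) √5

conj-* : ∀ x y → conj (x *₅ y) ≡ conj x *₅ conj y
conj-* (a ⊕ b √5) (c ⊕ d √5) = ⊕-cong (re-part a b c d five) (im-part a b c d)
  where
  re-part : ∀ a b c d k → a ℚ.* c ℚ.+ k ℚ.* (b ℚ.* d) ≡ a ℚ.* c ℚ.+ k ℚ.* ((ℚ.- b) ℚ.* (ℚ.- d))
  re-part = solve-∀ ℚ-ring
  im-part : ∀ a b c d → ℚ.- (a ℚ.* d ℚ.+ b ℚ.* c) ≡ a ℚ.* (ℚ.- d) ℚ.+ (ℚ.- b) ℚ.* c
  im-part = solve-∀ ℚ-ring

conj-^₅ : ∀ x n → conj (x ^₅ n) ≡ conj x ^₅ n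
conj-^₅ x zero    = refl
conj-^₅ x (suc n) = trans (conj-* x (x ^₅ n)) (cong (conj x *₅_) (conj-^₅ x n))

α^₅-signs : ∀ k → ℚ.Positive (re (α ^₅ k)) × ℚ.NonNegative (im (α ^₅ k))
α^₅-signs zero    = _ , _
α^₅-signs (suc k) =
  ℚₚ.pos+nonNeg⇒pos (½ ℚ.* a) {{½a>0}} (five ℚ.* (½ ℚ.* b))
    {{ℚₚ.nonNeg*nonNeg⇒nonNeg five {{_}} (½ ℚ.* b) {{½b≥0}}}} ,
  ℚₚ.pos⇒nonNeg (½ ℚ.* b ℚ.+ ½ ℚ.* a) {{ℚₚ.nonNeg+pos⇒pos (½ ℚ.* b) {{½b≥0}} (½ ℚ.* a) {{½a>0}}}}
  where
  ½ = + 1 ℚ./ 2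
  a = re (α ^₅ k)
  b = im (α ^₅ k)
  ½a>0 : ℚ.Positive (½ ℚ.* a)
  ½a>0 = ℚₚ.pos*pos⇒pos ½ {{_}} a {{proj₁ (α^₅-signs k)}}
  ½b≥0 : ℚ.NonNegative (½ ℚ.* b)
  ½b≥0 = ℚₚ.nonNeg*nonNeg⇒nonNeg ½ {{_}} b {{proj₂ (α^₅-signs k)}}

-- β = conj α, so Lₖ = αᵏ + conj αᵏ = 2 re αᵏ.
L-nonneg-invertible : ∀ k → L (+ k) *₅ inv₅ (L (+ k)) ≡ 1₅
L-nonneg-invertible k = inv₅-inverseʳ (L (+ k)) norm≢0
  where
  a = re (α ^₅ k)
  b = im (α ^₅ k)
  drop-im : ∀ a b k → (a ℚ.+ a) ℚ.* (a ℚ.+ a) ℚ.- k ℚ.* ((b ℚ.+ ℚ.- b) ℚ.* (b ℚ.+ ℚ.- b))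
                      ≡ (a ℚ.+ a) ℚ.* (a ℚ.+ a)
  drop-im = solve-∀ ℚ-ring
  norm-L : norm (L (+ k)) ≡ (a ℚ.+ a) ℚ.* (a ℚ.+ a)
  norm-L = trans (cong (λ y → norm (α ^₅ k +₅ y)) (sym (conj-^₅ α k))) (drop-im a b five)
  2a>0 : ℚ.Positive (a ℚ.+ a)
  2a>0 = ℚₚ.pos+pos⇒pos a {{proj₁ (α^₅-signs k)}} a {{proj₁ (α^₅-signs k)}}
  norm>0 : 0ℚ ℚ.< norm (L (+ k))
  norm>0 = subst (0ℚ ℚ.<_) (sym norm-L)
             (ℚₚ.positive⁻¹ _ {{ℚₚ.pos*pos⇒pos (a ℚ.+ a) {{2a>0}} (a ℚ.+ a) {{2a>0}}}})
  norm≢0 : ¬ norm (L (+ k)) ≡ 0ℚ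
  norm≢0 N≡0 = ℚₚ.<-irrefl refl (subst (0ℚ ℚ.<_) N≡0 norm>0)

-- inv₅ α and inv₅ β compute to -β and -α.
L-neg : ∀ n → L -[1+ n ] ≡ sgn (suc n) *₅ L (+ suc n)
L-neg n = begin
  inv₅ (α ^₅ k) +₅ inv₅ (β ^₅ k)       ≡⟨ cong₂ _+₅_ (inv₅-^₅ α refl k) (inv₅-^₅ β refl k) ⟩
  (-₅ β) ^₅ k +₅ (-₅ α) ^₅ k           ≡⟨ cong₂ _+₅_ (-₅-^₅ β k) (-₅-^₅ α k) ⟩
  sgn k *₅ β ^₅ k +₅ sgn k *₅ α ^₅ k   ≡⟨ factor (sgn k) (α ^₅ k) (β ^₅ k) ⟩
  sgn k *₅ L (+ k)                     ∎
  where
  k = suc n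
  factor : ∀ s a b → s *₅ b +₅ s *₅ a ≡ s *₅ (a +₅ b)
  factor = solve-∀ Q5-ring

L-invertible : ∀ j → L j *₅ inv₅ (L j) ≡ 1₅
L-invertible (+ k)     = L-nonneg-invertible k
L-invertible -[1+ n ] = trans (cong (L -[1+ n ] *₅_) (inv₅-unique (L -[1+ n ]) y L*y≡1)) L*y≡1
  where
  s = sgn (suc n)
  ℓ = L (+ suc n)
  y = s *₅ inv₅ ℓ
  interchange : ∀ s ℓ i → (s *₅ ℓ) *₅ (s *₅ i) ≡ (s *₅ s) *₅ (ℓ *₅ i)
  interchange = solve-∀ Q5-ring
  L*y≡1 : L -[1+ n ] *₅ y ≡ 1₅
  L*y≡1 = begin
    L -[1+ n ] *₅ y              ≡⟨ cong (_*₅ y) (L-neg n) ⟩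
    (s *₅ ℓ) *₅ (s *₅ inv₅ ℓ)    ≡⟨ interchange s ℓ (inv₅ ℓ) ⟩
    (s *₅ s) *₅ (ℓ *₅ inv₅ ℓ)    ≡⟨ cong₂ _*₅_ (sgn*sgn≡1 (suc n)) (L-nonneg-invertible (suc n)) ⟩
    1₅ *₅ 1₅                     ≡⟨ *₅-identityˡ 1₅ ⟩
    1₅                           ∎

binet : Q5 → Q5 → ℤ → Q5
binet u v s = u *₅ α ^ℤ s +₅ v *₅ β ^ℤ s

F≡binet : ∀ s → F s ≡ binet (inv₅ √5) (-₅ inv₅ √5) s
F≡binet s = distribute (α ^ℤ s) (β ^ℤ s) (inv₅ √5)
  where
  distribute : ∀ x y r → (x -₅ y) *₅ r ≡ r *₅ x +₅ (-₅ r) *₅ y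
  distribute = solve-∀ Q5-ring

L≡binet : ∀ s → L s ≡ binet 1₅ 1₅ s
L≡binet s = unit-coefficients (α ^ℤ s) (β ^ℤ s)
  where
  unit-coefficients : ∀ x y → x +₅ y ≡ 1₅ *₅ x +₅ 1₅ *₅ y
  unit-coefficients = solve-∀ Q5-ring

β^j/L≡1-α^j/L : ∀ j → (β ^ℤ j) /₅ L j ≡ 1₅ -₅ (α ^ℤ j) /₅ L j
β^j/L≡1-α^j/L j = trans (complement (α ^ℤ j) (β ^ℤ j) (inv₅ (L j)))
                        (cong (_-₅ (α ^ℤ j) /₅ L j) (L-invertible j))
  where
  complement : ∀ x y u → y *₅ u ≡ (x +₅ y) *₅ u -₅ x *₅ u
  complement = solve-∀ Q5-ring

binet-ratio : ∀ u v j m k →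
  binet u v (j * + k + m) /₅ (L j ^₅ k)
    ≡ (u *₅ α ^ℤ m) *₅ ((α ^ℤ j) /₅ L j) ^₅ k +₅ (v *₅ β ^ℤ m) *₅ (1₅ -₅ (α ^ℤ j) /₅ L j) ^₅ k
binet-ratio u v j m k = begin
  (u *₅ α ^ℤ (j * + k + m) +₅ v *₅ β ^ℤ (j * + k + m)) *₅ inv₅ (L j ^₅ k)
    ≡⟨ cong₂ (λ x y → (u *₅ x +₅ v *₅ y) *₅ inv₅ (L j ^₅ k)) (α^.^ℤ-affine j k m) (β^.^ℤ-affine j k m) ⟩
  (u *₅ (X ^₅ k *₅ P) +₅ v *₅ (Y ^₅ k *₅ Q)) *₅ inv₅ (L j ^₅ k)
    ≡⟨ cong (λ w → (u *₅ (X ^₅ k *₅ P) +₅ v *₅ (Y ^₅ k *₅ Q)) *₅ w) (inv₅-^₅ (L j) (L-invertible j) k) ⟩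
  (u *₅ (X ^₅ k *₅ P) +₅ v *₅ (Y ^₅ k *₅ Q)) *₅ U ^₅ k
    ≡⟨ regroup u v (X ^₅ k) (Y ^₅ k) P Q (U ^₅ k) ⟩
  (u *₅ P) *₅ (X ^₅ k *₅ U ^₅ k) +₅ (v *₅ Q) *₅ (Y ^₅ k *₅ U ^₅ k)
    ≡⟨ cong₂ (λ x y → (u *₅ P) *₅ x +₅ (v *₅ Q) *₅ y) (^₅-distrib-* X U k) (^₅-distrib-* Y U k) ⟨
  (u *₅ P) *₅ (X *₅ U) ^₅ k +₅ (v *₅ Q) *₅ (Y *₅ U) ^₅ k
    ≡⟨ cong (λ y → (u *₅ P) *₅ (X *₅ U) ^₅ k +₅ (v *₅ Q) *₅ y ^₅ k) (β^j/L≡1-α^j/L j) ⟩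
  (u *₅ P) *₅ (X *₅ U) ^₅ k +₅ (v *₅ Q) *₅ (1₅ -₅ X *₅ U) ^₅ k ∎
  where
  X = α ^ℤ j
  Y = β ^ℤ j
  P = α ^ℤ m
  Q = β ^ℤ m
  U = inv₅ (L j)
  regroup : ∀ u v x y p q w → (u *₅ (x *₅ p) +₅ v *₅ (y *₅ q)) *₅ w
                              ≡ (u *₅ p) *₅ (x *₅ w) +₅ (v *₅ q) *₅ (y *₅ w)
  regroup = solve-∀ Q5-ring

alternatingSum : ℤ → ℤ → ℕ → (ℤ → Q5) → Q5
alternatingSum j m n G =
  sumTo n (λ k → sgn k *₅ fromℕ (n C k) *₅ (G (j * + k + m) /₅ (L j ^₅ k)) *₅ fromℚ (Bern (n ∸ k)))

-- For n = 0 the exponent + n - + 1 is negative, but the factor n = 0 kills the term.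
correctionTerm : ℤ → ℤ → ℕ → (ℤ → Q5) → Q5
correctionTerm j m n G = fromℕ n *₅ (G (j * (+ n - + 1) + m) /₅ (L j ^ℤ (+ n - + 1)))

alternatingSum-cong : ∀ j m n {G H} → (∀ s → G s ≡ H s) → alternatingSum j m n G ≡ alternatingSum j m n H
alternatingSum-cong j m n G≗H = sumTo-cong n λ k →
  cong (λ x → sgn k *₅ fromℕ (n C k) *₅ (x /₅ (L j ^₅ k)) *₅ fromℚ (Bern (n ∸ k))) (G≗H (j * + k + m))

correctionTerm-cong : ∀ j m n {G H} → (∀ s → G s ≡ H s) → correctionTerm j m n G ≡ correctionTerm j m n H
correctionTerm-cong j m n G≗H =
  cong (λ x → fromℕ n *₅ (x /₅ (L j ^ℤ (+ n - + 1)))) (G≗H (j * (+ n - + 1) + m))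

correctionTerm-binet : ∀ u v j m n → correctionTerm j m n (binet u v)
  ≡ fromℕ n *₅ ((u *₅ α ^ℤ m) *₅ ((α ^ℤ j) /₅ L j) ^₅ (n ∸ 1)
                +₅ (v *₅ β ^ℤ m) *₅ (1₅ -₅ (α ^ℤ j) /₅ L j) ^₅ (n ∸ 1))
correctionTerm-binet u v j m zero    =
  trans (*₅-zeroˡ (binet u v (j * (+ 0 - + 1) + m) /₅ (L j ^ℤ (+ 0 - + 1))))
        (sym (*₅-zeroˡ ((u *₅ α ^ℤ m) *₅ 1₅ +₅ (v *₅ β ^ℤ m) *₅ 1₅)))
correctionTerm-binet u v j m (suc n) = cong (fromℕ (suc n) *₅_) (binet-ratio u v j m n)

alternatingSum-binet : ∀ j m n u v → alternatingSum j m n (binet u v)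
  ≡ sgn n *₅ ((u *₅ α ^ℤ m +₅ sgn n *₅ (v *₅ β ^ℤ m)) *₅ BernPoly n ((α ^ℤ j) /₅ L j)
              +₅ correctionTerm j m n (binet u v))
alternatingSum-binet j m n u v = begin
  alternatingSum j m n (binet u v)
    ≡⟨ sumTo-cong n (λ k → cong (λ x → sgn k *₅ fromℕ (n C k) *₅ x *₅ bern (n ∸ k)) (binet-ratio u v j m k)) ⟩
  sumTo n (λ k → sgn k *₅ fromℕ (n C k) *₅ (u′ *₅ t ^₅ k +₅ v′ *₅ (1₅ -₅ t) ^₅ k) *₅ bern (n ∸ k))
    ≡⟨ alternatingBernSum n t u′ v′ ⟩
  sgn n *₅ ((u′ +₅ sgn n *₅ v′) *₅ BernPoly n t
            +₅ fromℕ n *₅ (u′ *₅ t ^₅ (n ∸ 1) +₅ v′ *₅ (1₅ -₅ t) ^₅ (n ∸ 1)))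
    ≡⟨ cong (λ x → sgn n *₅ ((u′ +₅ sgn n *₅ v′) *₅ BernPoly n t +₅ x)) (correctionTerm-binet u v j m n) ⟨
  sgn n *₅ ((u′ +₅ sgn n *₅ v′) *₅ BernPoly n t +₅ correctionTerm j m n (binet u v)) ∎
  where
  t  = (α ^ℤ j) /₅ L j
  u′ = u *₅ α ^ℤ m
  v′ = v *₅ β ^ℤ m

alternatingSum-even : ∀ j m n {G} u v → (∀ s → G s ≡ binet u v s) → n % 2 ≡ 0 →
  alternatingSum j m n G ≡ G m *₅ BernPoly n ((α ^ℤ j) /₅ L j) +₅ correctionTerm j m n G
alternatingSum-even j m n {G} u v G≗binet even = begin
  alternatingSum j m n G
    ≡⟨ alternatingSum-cong j m n G≗binet ⟩
  alternatingSum j m n (binet u v)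
    ≡⟨ alternatingSum-binet j m n u v ⟩
  sgn n *₅ ((p +₅ sgn n *₅ q) *₅ B +₅ C)
    ≡⟨ cong (λ σ → σ *₅ ((p +₅ σ *₅ q) *₅ B +₅ C)) (trans (sgn-%2 n) (cong sgn even)) ⟩
  1₅ *₅ ((p +₅ 1₅ *₅ q) *₅ B +₅ C)
    ≡⟨ simplify p q B C ⟩
  binet u v m *₅ B +₅ C
    ≡⟨ cong₂ (λ g c → g *₅ B +₅ c) (G≗binet m) (correctionTerm-cong j m n G≗binet) ⟨
  G m *₅ B +₅ correctionTerm j m n G ∎
  where
  p = u *₅ α ^ℤ m
  q = v *₅ β ^ℤ m
  B = BernPoly n ((α ^ℤ j) /₅ L j)
  C = correctionTerm j m n (binet u v)
  simplify : ∀ p q B C → 1₅ *₅ ((p +₅ 1₅ *₅ q) *₅ B +₅ C) ≡ (p +₅ q) *₅ B +₅ C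
  simplify = solve-∀ Q5-ring

alternatingSum-odd : ∀ j m n {G} u v → (∀ s → G s ≡ binet u v s) → n % 2 ≡ 1 →
  alternatingSum j m n G ≡ -₅ (binet u (-₅ v) m *₅ BernPoly n ((α ^ℤ j) /₅ L j)) -₅ correctionTerm j m n G
alternatingSum-odd j m n {G} u v G≗binet odd = begin
  alternatingSum j m n G
    ≡⟨ alternatingSum-cong j m n G≗binet ⟩
  alternatingSum j m n (binet u v)
    ≡⟨ alternatingSum-binet j m n u v ⟩
  sgn n *₅ ((p +₅ sgn n *₅ q) *₅ B +₅ C)
    ≡⟨ cong (λ σ → σ *₅ ((p +₅ σ *₅ q) *₅ B +₅ C)) (trans (sgn-%2 n) (cong sgn odd)) ⟩
  (-₅ 1₅) *₅ ((p +₅ (-₅ 1₅) *₅ q) *₅ B +₅ C)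
    ≡⟨ simplify u (α ^ℤ m) v (β ^ℤ m) B C ⟩
  -₅ (binet u (-₅ v) m *₅ B) -₅ C
    ≡⟨ cong (λ c → -₅ (binet u (-₅ v) m *₅ B) -₅ c) (correctionTerm-cong j m n G≗binet) ⟨
  -₅ (binet u (-₅ v) m *₅ B) -₅ correctionTerm j m n G ∎
  where
  p = u *₅ α ^ℤ m
  q = v *₅ β ^ℤ m
  B = BernPoly n ((α ^ℤ j) /₅ L j)
  C = correctionTerm j m n (binet u v)
  simplify : ∀ u x v y B C → (-₅ 1₅) *₅ ((u *₅ x +₅ (-₅ 1₅) *₅ (v *₅ y)) *₅ B +₅ C)
                             ≡ -₅ ((u *₅ x +₅ (-₅ v) *₅ y) *₅ B) -₅ C
  simplify = solve-∀ Q5-ring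

L/√5≡binet : ∀ m → binet (inv₅ √5) (-₅ (-₅ inv₅ √5)) m ≡ L m /₅ √5
L/√5≡binet m = collect (α ^ℤ m) (β ^ℤ m) (inv₅ √5)
  where
  collect : ∀ x y r → r *₅ x +₅ (-₅ (-₅ r)) *₅ y ≡ (x +₅ y) *₅ r
  collect = solve-∀ Q5-ring

√5F≡binet : ∀ m → binet 1₅ (-₅ 1₅) m ≡ √5 *₅ F m
√5F≡binet m = begin
  1₅ *₅ x +₅ (-₅ 1₅) *₅ y        ≡⟨ difference x y ⟩
  1₅ *₅ (x -₅ y)                 ≡⟨ cong (_*₅ (x -₅ y)) √5*√5⁻¹≡1 ⟨
  (√5 *₅ inv₅ √5) *₅ (x -₅ y)    ≡⟨ regroup √5 (inv₅ √5) (x -₅ y) ⟩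
  √5 *₅ ((x -₅ y) *₅ inv₅ √5)    ∎
  where
  x = α ^ℤ m
  y = β ^ℤ m
  √5*√5⁻¹≡1 : √5 *₅ inv₅ √5 ≡ 1₅
  √5*√5⁻¹≡1 = refl
  difference : ∀ x y → 1₅ *₅ x +₅ (-₅ 1₅) *₅ y ≡ 1₅ *₅ (x -₅ y)
  difference = solve-∀ Q5-ring
  regroup : ∀ a b c → (a *₅ b) *₅ c ≡ a *₅ (c *₅ b)
  regroup = solve-∀ Q5-ring

theorem15 : (j m : ℤ) (n : ℕ) →
    ((n % 2 ≡ 0) →
       (sumTo n (λ k → sgn k *₅ fromℕ (n C k) *₅ (F (j * + k + m) /₅ (L j ^₅ k)) *₅ fromℚ (Bern (n ∸ k)))
          ≡ F m *₅ BernPoly n ((α ^ℤ j) /₅ L j)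
            +₅ fromℕ n *₅ (F (j * (+ n - + 1) + m) /₅ (L j ^ℤ (+ n - + 1))))
     × (sumTo n (λ k → sgn k *₅ fromℕ (n C k) *₅ (L (j * + k + m) /₅ (L j ^₅ k)) *₅ fromℚ (Bern (n ∸ k)))
          ≡ L m *₅ BernPoly n ((α ^ℤ j) /₅ L j)
            +₅ fromℕ n *₅ (L (j * (+ n - + 1) + m) /₅ (L j ^ℤ (+ n - + 1)))))
    × ((n % 2 ≡ 1) →
       (sumTo n (λ k → sgn k *₅ fromℕ (n C k) *₅ (F (j * + k + m) /₅ (L j ^₅ k)) *₅ fromℚ (Bern (n ∸ k)))
          ≡ -₅ ((L m /₅ √5) *₅ BernPoly n ((α ^ℤ j) /₅ L j))
            -₅ fromℕ n *₅ (F (j * (+ n - + 1) + m) /₅ (L j ^ℤ (+ n - + 1))))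
     × (sumTo n (λ k → sgn k *₅ fromℕ (n C k) *₅ (L (j * + k + m) /₅ (L j ^₅ k)) *₅ fromℚ (Bern (n ∸ k)))
          ≡ -₅ (√5 *₅ F m *₅ BernPoly n ((α ^ℤ j) /₅ L j))
            -₅ fromℕ n *₅ (L (j * (+ n - + 1) + m) /₅ (L j ^ℤ (+ n - + 1)))))
theorem15 j m n =
  (λ even → alternatingSum-even j m n r (-₅ r) F≡binet even
          , alternatingSum-even j m n 1₅ 1₅ L≡binet even) ,
  (λ odd → trans (alternatingSum-odd j m n r (-₅ r) F≡binet odd)
                 (cong (λ c → -₅ (c *₅ B) -₅ correctionTerm j m n F) (L/√5≡binet m))
         , trans (alternatingSum-odd j m n 1₅ 1₅ L≡binet odd)
                 (cong (λ c → -₅ (c *₅ B) -₅ correctionTerm j m n L) (√5F≡binet m)))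
  where
  r = inv₅ √5
  B = BernPoly n ((α ^ℤ j) /₅ L j)
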